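{- Let $m \geq 1$ and $n \geq 1$ be integers, and let $a_n(m)$ denote the number of permutations of $\{1,\ldots,n\}$ all of whose maximal increasing runs have lengths congruent to $0$ or $1$ modulo $2m$. Then \[ \chi_{2m-1}(K_n,-1) = (-1)^n a_n(m). \]
   Context: For a graph $G$ and positive integer $\lambda$, $\chi_r(G,\lambda)$ is the number of colorings of the vertices of $G$ with $\lambda$ colors such that every vertex $v$ has at most $r-1$ neighbors having the same color as $v$; this is a polynomial in $\lambda$ (the degree-chromatic polynomial), and $\chi_r(G,-1)$ is its value at $\lambda=-1$. $K_n$ is the complete graph on $n$ vertices. A maximal increasing run of a permutation $\sigma_1\cdots\sigma_n$ is a maximal block of consecutive positions $i, i+1,\ldots,j$ with $\sigma_i<\sigma_{i+1}<\cdots<\sigma_j$; its length is $j-i+1$. -}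

module Defs where

import Data.Bool
open import Data.Bool using (Bool; true; false; not; _∧_; if_then_else_)
import Data.Nat
open import Data.Nat using (ℕ; zero; suc; _+_; _*_; _∸_; _<ᵇ_; _≤ᵇ_)
open import Data.Nat.Divisibility using (_∣?_)
open import Data.Fin using (Fin; toℕ)
import Data.Fin as F
open import Data.List using (List; []; _∷_; [_]; map; concatMap; length; filterᵇ; foldr)
open import Data.List using () renaming (allFin to allFinL)
open import Data.Vec using (Vec; []; _∷_; lookup; toList)
open import Data.Integer using (ℤ; +_) renaming (_+_ to _+ℤ_; _*_ to _*ℤ_)
open import Relation.Nullary.Decidable using (⌊_⌋)

Graph : ℕ → Set
Graph n = Fin n → Fin n → Bool

K : (n : ℕ) → Graph n
K n u v = not ⌊ u F.≟ v ⌋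

-- All functions Fin n → Fin k, represented as vectors (each exactly once).
allVecs : (n k : ℕ) → List (Vec (Fin k) n)
allVecs zero    k = [ [] ]
allVecs (suc n) k = concatMap (λ v → map (_∷ v) (allFinL k)) (allVecs n k)

all : {A : Set} → (A → Bool) → List A → Bool
all p []       = true
all p (x ∷ xs) = p x ∧ all p xs

count : {A : Set} → (A → Bool) → List A → ℕ
count p xs = length (filterᵇ p xs)

admissible : {n k : ℕ} → ℕ → Graph n → Vec (Fin k) n → Bool
admissible {n} r G c =
  all (λ v → count (λ u → G v u ∧ ⌊ lookup c u F.≟ lookup c v ⌋) (allFinL n) ≤ᵇ (r ∸ 1))
      (allFinL n)

chiCount : {n : ℕ} → ℕ → Graph n → ℕ → ℕ
chiCount {n} r G q = count (admissible r G) (allVecs n q)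

-- Evaluation of an integer polynomial given by its coefficient list
-- (constant term first).
evalPoly : List ℤ → ℤ → ℤ
evalPoly []       x = + 0
evalPoly (a ∷ as) x = a +ℤ x *ℤ evalPoly as x

runLengths : List ℕ → List ℕ
runLengths []       = []
runLengths (x ∷ xs) = go x 1 xs
  where
  go : ℕ → ℕ → List ℕ → List ℕ
  go prev len []       = len ∷ []
  go prev len (y ∷ ys) = if prev <ᵇ y then go y (suc len) ys else len ∷ go y 1 ys

distinct : List ℕ → Bool
distinct []       = true
distinct (x ∷ xs) = all (λ y → not ⌊ x Data.Nat.≟ y ⌋) xs ∧ distinct xs

isPerm : {n : ℕ} → Vec (Fin n) n → Bool
isPerm v = distinct (map toℕ (toList v))

-- len ≡ 0 or 1 (mod d)   (run lengths are always ≥ 1)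
goodLen : ℕ → ℕ → Bool
goodLen d len = ⌊ d ∣? len ⌋ Data.Bool.∨ ⌊ d ∣? (len ∸ 1) ⌋

-- a_n(m): permutations of {1..n} (encoded as values 0..n-1, same order)
-- all of whose maximal increasing runs have length ≡ 0 or 1 mod 2m.
a : ℕ → ℕ → ℕ
a n m = count (λ v → isPerm v ∧ all (goodLen (2 * m)) (runLengths (map toℕ (toList v))))
              (allVecs n n)

{-# OPTIONS --safe #-}
module Submission where

-- χ_r(K_n, q) counts the words of length n over q colours in which no colour occurs more
-- than r times; splitting off the positions of one colour gives
-- χ_r(K_n, q + 1) = ∑_{j ≤ r} C(n, j) χ_r(K_{n−j}, q). The integer polynomials with P₀ = 1
-- and P_{n+1}(x) = x P_n(x) − C(n, r) x P_{n−r}(x − 1) satisfy the same recurrence and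
-- vanish at 0 for n ≥ 1, so P_n interpolates χ_r(K_n, ·), and at x = −1 the recurrence says
-- that Q_n = P_n(−1) satisfies ∑_{j ≤ r} C(n, j) Q_{n−j} = 0 for n ≥ 1.
--
-- Let r = 2m − 1 and let Z(ℓ, k) count the injective words of length ℓ over k letters all
-- of whose ascending runs have length ≡ 0, 1 (mod 2m), so that a_n(m) = Z(n, n). Peeling an
-- ascending block of length i + 1 ≤ r off the front of a word with sign (−1)^i reproduces
-- the indicator of that condition exactly: the good lengths form the pattern 1, 1, 0, …, 0
-- modulo r + 1, and r is odd. The ascending blocks avoiding the remaining letters are
-- counted by binomial coefficients, which turns this into a recurrence for Z solved by
-- Z(ℓ, k) = C(k, ℓ) (−1)^ℓ Q_ℓ; hence a_n(m) = (−1)^n χ_{2m−1}(K_n, −1).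

open import Defs

module _ where

  open import Data.Bool using (Bool; true; false; not; _∧_; _∨_; if_then_else_)
  open import Data.Nat as ℕ using (ℕ; zero; suc; pred; _∸_; _≤_; _<_; z≤n; s≤s; _≤ᵇ_; _<ᵇ_)
  import Data.Nat.Properties as ℕP
  open import Data.Nat.Combinatorics using (_C_; nCn≡1; nCk≡nC[n∸k]; nCk+nC[k+1]≡[n+1]C[k+1])
    renaming (k>n⇒nCk≡0 to nCk≡0)
  open import Data.Integer using (ℤ; +_; -_; _+_; _*_; _-_; _^_; 0ℤ; 1ℤ; -1ℤ)
  import Data.Integer.Properties as ℤP
  open import Data.Integer.Tactic.RingSolver using (solve-∀)
  import Data.Nat.Tactic.RingSolver as ℕ-Solver
  open import Data.Fin as Fin using (Fin; toℕ)
  import Data.Fin.Properties as FinP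
  open import Data.List using (List; []; _∷_; _++_; map; concatMap; tabulate; length; take; drop)
    renaming (allFin to allFinL)
  open import Data.Vec using (Vec; []; _∷_; toList; lookup) renaming (_++_ to _++ᵛ_)
  open import Data.Sum using (inj₁; inj₂)
  open import Relation.Binary.Definitions using (tri<; tri≈; tri>)
  open import Data.Product using (∃; _,_; proj₁; proj₂)
  open import Data.Bool.Properties using (∧-conical; ∧-zeroʳ; ∨-zeroʳ; T-≡; ¬-not)
  open import Function.Bundles using (Equivalence; mk⇔)
  open import Data.Nat.Divisibility using (_∣?_; _∣0; ∣-refl; ∣m+n∣m⇒∣n; ∣m∣n⇒∣m+n; >⇒∤)
  open import Data.Empty using (⊥-elim)
  open import Data.List.Properties using (length-++)
  open import Data.List.Membership.Propositional using (_∈_)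
  open import Data.List.Membership.Propositional.Properties using (∈-allFin)
  open import Data.List.Relation.Unary.Any using (here; there)
  open import Relation.Nullary using (yes; no)
  open import Relation.Nullary.Decidable using (⌊_⌋; isYes≗does; dec-true; dec-false; does-⇔; ⌊⌋-map′)
  open import Relation.Binary.PropositionalEquality
  open import Data.Nat.Induction using (<-rec)
  open import Algebra.Properties.Semiring.Sum ℤP.+-*-semiring
    using (sum; sum-syntax; ∑-distrib-+; *-distribˡ-sum; *-distribʳ-sum; sum-cong-≗; sum-init-last; sum-replicate-zero)

  private
    variable
      A B : Set

  𝟙 : Bool → ℤ
  𝟙 true  = 1ℤ
  𝟙 false = 0ℤ

  𝟙-∧ : ∀ b c → 𝟙 (b ∧ c) ≡ 𝟙 b * 𝟙 c
  𝟙-∧ true  c = sym (ℤP.*-identityˡ (𝟙 c))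
  𝟙-∧ false c = refl

  sumOver : List A → (A → ℤ) → ℤ
  sumOver []       f = 0ℤ
  sumOver (x ∷ xs) f = f x + sumOver xs f

  infixl 10 sumOver
  syntax sumOver xs (λ x → e) = ∑[ x ∈ xs ] e

  sumOver-cong : ∀ (xs : List A) {f g : A → ℤ} → (∀ x → f x ≡ g x) → sumOver xs f ≡ sumOver xs g
  sumOver-cong []       eq = refl
  sumOver-cong (x ∷ xs) eq = cong₂ _+_ (eq x) (sumOver-cong xs eq)

  sumOver-zero : ∀ (xs : List A) {f : A → ℤ} → (∀ x → f x ≡ 0ℤ) → sumOver xs f ≡ 0ℤ
  sumOver-zero []       eq = refl
  sumOver-zero (x ∷ xs) eq = cong₂ _+_ (eq x) (sumOver-zero xs eq)

  sumOver-++ : ∀ (xs ys : List A) (f : A → ℤ) → sumOver (xs ++ ys) f ≡ sumOver xs f + sumOver ys f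
  sumOver-++ []       ys f = sym (ℤP.+-identityˡ _)
  sumOver-++ (x ∷ xs) ys f = trans (cong (_+_ (f x)) (sumOver-++ xs ys f)) (sym (ℤP.+-assoc (f x) _ _))

  sumOver-map : ∀ (g : A → B) (xs : List A) (f : B → ℤ) →
                sumOver (map g xs) f ≡ ∑[ x ∈ xs ] f (g x)
  sumOver-map g []       f = refl
  sumOver-map g (x ∷ xs) f = cong (_+_ (f (g x))) (sumOver-map g xs f)

  sumOver-concatMap : ∀ (g : A → List B) (xs : List A) (f : B → ℤ) →
                      sumOver (concatMap g xs) f ≡ ∑[ x ∈ xs ] sumOver (g x) f
  sumOver-concatMap g []       f = refl
  sumOver-concatMap g (x ∷ xs) f =
    trans (sumOver-++ (g x) (concatMap g xs) f) (cong (_+_ (sumOver (g x) f)) (sumOver-concatMap g xs f))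

  sumOver-distrib-+ : ∀ (xs : List A) (f g : A → ℤ) →
                      ∑[ x ∈ xs ] (f x + g x) ≡ sumOver xs f + sumOver xs g
  sumOver-distrib-+ []       f g = refl
  sumOver-distrib-+ (x ∷ xs) f g =
    trans (cong (_+_ (f x + g x)) (sumOver-distrib-+ xs f g)) (interchange (f x) (g x) _ _)
    where
    interchange : ∀ a b c d → (a + b) + (c + d) ≡ (a + c) + (b + d)
    interchange = solve-∀

  *-distribˡ-sumOver : ∀ c (xs : List A) (f : A → ℤ) → c * sumOver xs f ≡ ∑[ x ∈ xs ] (c * f x)
  *-distribˡ-sumOver c []       f = ℤP.*-zeroʳ c
  *-distribˡ-sumOver c (x ∷ xs) f =
    trans (ℤP.*-distribˡ-+ c (f x) _) (cong (_+_ (c * f x)) (*-distribˡ-sumOver c xs f))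

  sumOver-comm-∑ : ∀ (xs : List A) k (f : A → Fin k → ℤ) →
                   ∑[ x ∈ xs ] ∑[ i < k ] f x i ≡ ∑[ i < k ] ∑[ x ∈ xs ] f x i
  sumOver-comm-∑ []       k f = sym (sum-replicate-zero k)
  sumOver-comm-∑ (x ∷ xs) k f =
    trans (cong (_+_ (sum (f x))) (sumOver-comm-∑ xs k f)) (sym (∑-distrib-+ (f x) _))

  count≡sumOver : ∀ (p : A → Bool) (xs : List A) → + count p xs ≡ ∑[ x ∈ xs ] 𝟙 (p x)
  count≡sumOver p []       = refl
  count≡sumOver p (x ∷ xs) with p x
  ... | true  = trans (ℤP.pos-+ 1 (count p xs)) (cong (_+_ 1ℤ) (count≡sumOver p xs))
  ... | false = trans (count≡sumOver p xs) (sym (ℤP.+-identityˡ _))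

  ∑-cong : ∀ k {f g : Fin k → ℤ} → (∀ i → f i ≡ g i) → ∑[ i < k ] f i ≡ ∑[ i < k ] g i
  ∑-cong k = sum-cong-≗ {k}

  ∑-zero : ∀ k {f : Fin k → ℤ} → (∀ i → f i ≡ 0ℤ) → ∑[ i < k ] f i ≡ 0ℤ
  ∑-zero k eq = trans (∑-cong k eq) (sum-replicate-zero k)

  ∑-init-last : ∀ k (f : ℕ → ℤ) → ∑[ j < suc k ] f (toℕ j) ≡ ∑[ j < k ] f (toℕ j) + f k
  ∑-init-last k f = trans (sum-init-last {n = k} (λ j → f (toℕ j)))
    (cong₂ _+_ (∑-cong k (λ j → cong f (FinP.toℕ-inject₁ j))) (cong f (FinP.toℕ-fromℕ k)))

  ∑-linear : ∀ k a b (f g : Fin k → ℤ) → ∑[ j < k ] (a * f j - b * g j) ≡ a * sum f - b * sum g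
  ∑-linear k a b f g = begin
    ∑[ j < k ] (a * f j - b * g j)
      ≡⟨ ∑-distrib-+ (λ j → a * f j) (λ j → - (b * g j)) ⟩
    ∑[ j < k ] (a * f j) + ∑[ j < k ] (- (b * g j))
      ≡⟨ cong₂ _+_ (sym (*-distribˡ-sum {k} a f)) (∑-cong k (λ j → ℤP.neg-distribˡ-* b (g j))) ⟩
    a * sum f + ∑[ j < k ] ((- b) * g j)
      ≡⟨ cong (_+_ (a * sum f)) (trans (sym (*-distribˡ-sum {k} (- b) g)) (sym (ℤP.neg-distribˡ-* b (sum g)))) ⟩
    a * sum f - b * sum g
      ∎
    where open ≡-Reasoning

  sumOver-tabulate : ∀ k (g : Fin k → A) (f : A → ℤ) → ∑[ x ∈ tabulate g ] f x ≡ ∑[ i < k ] f (g i)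
  sumOver-tabulate zero    g f = refl
  sumOver-tabulate (suc k) g f = cong (_+_ (f (g Fin.zero))) (sumOver-tabulate k (λ i → g (Fin.suc i)) f)

  sumOver-allFin : ∀ k (f : Fin k → ℤ) → ∑[ x ∈ allFinL k ] f x ≡ ∑[ i < k ] f i
  sumOver-allFin k = sumOver-tabulate k (λ i → i)

  sumOver-allVecs-suc : ∀ n k (F : Vec (Fin k) (suc n) → ℤ) →
    ∑[ w ∈ allVecs (suc n) k ] F w ≡ ∑[ v ∈ allVecs n k ] ∑[ x < k ] F (x ∷ v)
  sumOver-allVecs-suc n k F =
    trans (sumOver-concatMap (λ v → map (_∷ v) (allFinL k)) (allVecs n k) F)
          (sumOver-cong (allVecs n k) λ v →
            trans (sumOver-map (_∷ v) (allFinL k) F) (sumOver-allFin k (λ x → F (x ∷ v))))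

  sumOver-allVecs-++ : ∀ p n k (F : Vec (Fin k) (p ℕ.+ n) → ℤ) →
    ∑[ w ∈ allVecs (p ℕ.+ n) k ] F w ≡ ∑[ v ∈ allVecs n k ] ∑[ u ∈ allVecs p k ] F (u ++ᵛ v)
  sumOver-allVecs-++ zero    n k F = sumOver-cong (allVecs n k) (λ v → sym (ℤP.+-identityʳ (F v)))
  sumOver-allVecs-++ (suc p) n k F = begin
    ∑[ w ∈ allVecs (suc p ℕ.+ n) k ] F w
      ≡⟨ sumOver-allVecs-suc (p ℕ.+ n) k F ⟩
    ∑[ w ∈ allVecs (p ℕ.+ n) k ] ∑[ x < k ] F (x ∷ w)
      ≡⟨ sumOver-allVecs-++ p n k (λ w → ∑[ x < k ] F (x ∷ w)) ⟩
    ∑[ v ∈ allVecs n k ] ∑[ u ∈ allVecs p k ] ∑[ x < k ] F (x ∷ u ++ᵛ v)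
      ≡⟨ sumOver-cong (allVecs n k) (λ v → sym (sumOver-allVecs-suc p k (λ u → F (u ++ᵛ v)))) ⟩
    ∑[ v ∈ allVecs n k ] ∑[ u ∈ allVecs (suc p) k ] F (u ++ᵛ v)
      ∎
    where open ≡-Reasoning

  -1^suc : ∀ n → -1ℤ ^ suc n ≡ - (-1ℤ ^ n)
  -1^suc n = ℤP.-1*i≡-i (-1ℤ ^ n)

  -1^n*-1^n : ∀ n → -1ℤ ^ n * -1ℤ ^ n ≡ 1ℤ
  -1^n*-1^n zero    = refl
  -1^n*-1^n (suc n) = trans (square-neg (-1ℤ ^ n)) (-1^n*-1^n n)
    where
    square-neg : ∀ s → (-1ℤ * s) * (-1ℤ * s) ≡ s * s
    square-neg = solve-∀

  ∑-sign-suc : ∀ k (f : ℕ → ℤ) →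
    ∑[ i < k ] (-1ℤ ^ suc (toℕ i) * f (toℕ i)) ≡ - ∑[ i < k ] (-1ℤ ^ toℕ i * f (toℕ i))
  ∑-sign-suc k f = begin
    ∑[ i < k ] (-1ℤ ^ suc (toℕ i) * f (toℕ i))     ≡⟨ ∑-cong k (λ i → ℤP.*-assoc -1ℤ (-1ℤ ^ toℕ i) (f (toℕ i))) ⟩
    ∑[ i < k ] (-1ℤ * (-1ℤ ^ toℕ i * f (toℕ i)))   ≡⟨ *-distribˡ-sum {k} -1ℤ (λ i → -1ℤ ^ toℕ i * f (toℕ i)) ⟨
    -1ℤ * ∑[ i < k ] (-1ℤ ^ toℕ i * f (toℕ i))     ≡⟨ ℤP.-1*i≡-i _ ⟩
    - ∑[ i < k ] (-1ℤ ^ toℕ i * f (toℕ i))         ∎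
    where open ≡-Reasoning

  ∸-∸-comm : ∀ n j k → n ∸ j ∸ k ≡ n ∸ k ∸ j
  ∸-∸-comm n j k = trans (ℕP.∸-+-assoc n j k) (trans (cong (n ∸_) (ℕP.+-comm j k)) (sym (ℕP.∸-+-assoc n k j)))

  C-pascal : ∀ n k → suc n C suc k ≡ n C k ℕ.+ n C suc k
  C-pascal n k = sym (nCk+nC[k+1]≡[n+1]C[k+1] n k)

  C-choose-twice-comm : ∀ n j k → (n C j) ℕ.* ((n ∸ j) C k) ≡ (n C k) ℕ.* ((n ∸ k) C j)
  C-choose-twice-comm zero    zero    zero    = refl
  C-choose-twice-comm zero    zero    (suc k) = refl
  C-choose-twice-comm zero    (suc j) zero    = refl
  C-choose-twice-comm zero    (suc j) (suc k) = refl
  C-choose-twice-comm (suc n) zero    k       = trans (ℕP.+-identityʳ _) (sym (ℕP.*-identityʳ _))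
  C-choose-twice-comm (suc n) (suc j) zero    = trans (ℕP.*-identityʳ _) (sym (ℕP.+-identityʳ _))
  C-choose-twice-comm (suc n) (suc j) (suc k) = begin
    (suc n C suc j) ℕ.* ((n ∸ j) C suc k)
      ≡⟨ expand j k ⟩
    T j (suc k) ℕ.+ (T (suc j) (suc k) ℕ.+ T (suc j) k)
      ≡⟨ cong₂ ℕ._+_ (C-choose-twice-comm n j (suc k))
           (cong₂ ℕ._+_ (C-choose-twice-comm n (suc j) (suc k)) (C-choose-twice-comm n (suc j) k)) ⟩
    T (suc k) j ℕ.+ (T (suc k) (suc j) ℕ.+ T k (suc j))
      ≡⟨ rearrange (T (suc k) j) (T (suc k) (suc j)) (T k (suc j)) ⟩
    T k (suc j) ℕ.+ (T (suc k) (suc j) ℕ.+ T (suc k) j)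
      ≡⟨ sym (expand k j) ⟩
    (suc n C suc k) ℕ.* ((n ∸ k) C suc j)
      ∎
    where
    open ≡-Reasoning
    T : ℕ → ℕ → ℕ
    T a b = (n C a) ℕ.* ((n ∸ a) C b)
    pascal-below : ∀ a b → (n C suc a) ℕ.* ((n ∸ a) C suc b) ≡ T (suc a) (suc b) ℕ.+ T (suc a) b
    pascal-below a b with ℕP.<-cmp a n
    ... | tri< a<n _ _ rewrite ℕP.+-∸-assoc 1 a<n =
      trans (cong ((n C suc a) ℕ.*_) (C-pascal (n ∸ suc a) b))
            (trans (ℕP.*-distribˡ-+ (n C suc a) _ _) (ℕP.+-comm (T (suc a) b) _))
    ... | tri≈ _ refl _ rewrite nCk≡0 (ℕP.n<1+n a) = refl
    ... | tri> _ _ n<a rewrite nCk≡0 (ℕP.m<n⇒m<1+n n<a) = refl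
    expand : ∀ a b → (suc n C suc a) ℕ.* ((n ∸ a) C suc b) ≡ T a (suc b) ℕ.+ (T (suc a) (suc b) ℕ.+ T (suc a) b)
    expand a b = trans (cong (ℕ._* ((n ∸ a) C suc b)) (C-pascal n a))
      (trans (ℕP.*-distribʳ-+ ((n ∸ a) C suc b) (n C a) _) (cong (T a (suc b) ℕ.+_) (pascal-below a b)))
    rearrange : ∀ x y z → x ℕ.+ (y ℕ.+ z) ≡ z ℕ.+ (y ℕ.+ x)
    rearrange = ℕ-Solver.solve-∀

  C-subset-of-subset : ∀ k ℓ p → p ≤ ℓ → (k C (ℓ ∸ p)) ℕ.* ((k ∸ (ℓ ∸ p)) C p) ≡ (k C ℓ) ℕ.* (ℓ C p)
  C-subset-of-subset k ℓ p p≤ℓ with ℕP.≤-<-connex ℓ k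
  ... | inj₁ ℓ≤k = begin
    (k C (ℓ ∸ p)) ℕ.* ((k ∸ (ℓ ∸ p)) C p)    ≡⟨ C-choose-twice-comm k (ℓ ∸ p) p ⟩
    (k C p) ℕ.* ((k ∸ p) C (ℓ ∸ p))          ≡⟨ cong ((k C p) ℕ.*_) (nCk≡nC[n∸k] (ℕP.∸-monoˡ-≤ p ℓ≤k)) ⟩
    (k C p) ℕ.* ((k ∸ p) C (k ∸ p ∸ (ℓ ∸ p))) ≡⟨ cong (λ i → (k C p) ℕ.* ((k ∸ p) C i)) k-p-[ℓ-p]≡k-ℓ ⟩
    (k C p) ℕ.* ((k ∸ p) C (k ∸ ℓ))          ≡⟨ C-choose-twice-comm k p (k ∸ ℓ) ⟩
    (k C (k ∸ ℓ)) ℕ.* ((k ∸ (k ∸ ℓ)) C p)    ≡⟨ cong₂ (λ a b → a ℕ.* (b C p)) (sym (nCk≡nC[n∸k] ℓ≤k)) (ℕP.m∸[m∸n]≡n ℓ≤k) ⟩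
    (k C ℓ) ℕ.* (ℓ C p)                      ∎
    where
    open ≡-Reasoning
    k-p-[ℓ-p]≡k-ℓ : k ∸ p ∸ (ℓ ∸ p) ≡ k ∸ ℓ
    k-p-[ℓ-p]≡k-ℓ = trans (ℕP.∸-+-assoc k p (ℓ ∸ p)) (cong (k ∸_) (ℕP.m+[n∸m]≡n p≤ℓ))
  ... | inj₂ k<ℓ rewrite nCk≡0 k<ℓ with ℕP.≤-<-connex (ℓ ∸ p) k
  ...   | inj₂ k<ℓ-p rewrite nCk≡0 k<ℓ-p = refl
  ...   | inj₁ ℓ-p≤k = trans (cong ((k C (ℓ ∸ p)) ℕ.*_) (nCk≡0 k-[ℓ-p]<p)) (ℕP.*-zeroʳ (k C (ℓ ∸ p)))
    where
    k-[ℓ-p]<p : k ∸ (ℓ ∸ p) < p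
    k-[ℓ-p]<p = ℕP.+-cancelʳ-< (ℓ ∸ p) _ p
      (subst₂ _<_ (sym (ℕP.m∸n+n≡m ℓ-p≤k)) (sym (ℕP.m+[n∸m]≡n p≤ℓ)) k<ℓ)

  ∑-pascal : ∀ n k (F : ℕ → ℤ) →
    ∑[ j < suc k ] (+ (suc n C toℕ j) * F (toℕ j)) ≡
    ∑[ j < suc k ] (+ (n C toℕ j) * F (toℕ j)) + ∑[ j < k ] (+ (n C toℕ j) * F (suc (toℕ j)))
  ∑-pascal n k F = begin
    + 1 * F 0 + ∑[ j < k ] (+ (suc n C suc (toℕ j)) * F (suc (toℕ j)))
      ≡⟨ cong (_+_ (+ 1 * F 0)) (trans (∑-cong k split) (∑-distrib-+ below above)) ⟩
    + 1 * F 0 + (sum below + sum above)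
      ≡⟨ rearrange (+ 1 * F 0) (sum below) (sum above) ⟩
    (+ 1 * F 0 + sum above) + sum below
      ∎
    where
    open ≡-Reasoning
    below above : Fin k → ℤ
    below j = + (n C toℕ j) * F (suc (toℕ j))
    above j = + (n C suc (toℕ j)) * F (suc (toℕ j))
    split : ∀ j → + (suc n C suc (toℕ j)) * F (suc (toℕ j)) ≡ below j + above j
    split j = trans (cong (λ c → + c * F (suc (toℕ j))) (C-pascal n (toℕ j)))
      (trans (cong (_* F (suc (toℕ j))) (ℤP.pos-+ (n C toℕ j) _))
             (ℤP.*-distribʳ-+ (F (suc (toℕ j))) (+ (n C toℕ j)) (+ (n C suc (toℕ j)))))
    rearrange : ∀ a b c → a + (b + c) ≡ (a + c) + b
    rearrange = solve-∀

  pascal-weighted : ∀ n j (V : ℕ → ℤ) →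
    + (n C j) * V (n ∸ j) + + (n C suc j) * V (suc (n ∸ suc j)) ≡ + (suc n C suc j) * V (n ∸ j)
  pascal-weighted n j V with ℕP.≤-<-connex (suc j) n
  ... | inj₁ j<n = begin
    + (n C j) * V (n ∸ j) + + (n C suc j) * V (suc (n ∸ suc j))
      ≡⟨ cong (λ m → + (n C j) * V (n ∸ j) + + (n C suc j) * V m) (sym (ℕP.+-∸-assoc 1 j<n)) ⟩
    + (n C j) * V (n ∸ j) + + (n C suc j) * V (n ∸ j)
      ≡⟨ ℤP.*-distribʳ-+ (V (n ∸ j)) (+ (n C j)) (+ (n C suc j)) ⟨
    (+ (n C j) + + (n C suc j)) * V (n ∸ j)
      ≡⟨ cong (_* V (n ∸ j)) (trans (sym (ℤP.pos-+ (n C j) (n C suc j))) (cong +_ (sym (C-pascal n j)))) ⟩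
    + (suc n C suc j) * V (n ∸ j)
      ∎
    where open ≡-Reasoning
  ... | inj₂ n<j+1 = begin
    + (n C j) * V (n ∸ j) + + (n C suc j) * V (suc (n ∸ suc j))
      ≡⟨ cong (λ c → + (n C j) * V (n ∸ j) + + c * V (suc (n ∸ suc j))) (nCk≡0 n<j+1) ⟩
    + (n C j) * V (n ∸ j) + 0ℤ
      ≡⟨ ℤP.+-identityʳ _ ⟩
    + (n C j) * V (n ∸ j)
      ≡⟨ cong (λ c → + c * V (n ∸ j))
           (sym (trans (C-pascal n j) (trans (cong ((n C j) ℕ.+_) (nCk≡0 n<j+1)) (ℕP.+-identityʳ _)))) ⟩
    + (suc n C suc j) * V (n ∸ j)
      ∎
    where open ≡-Reasoning

  C-signed-subset-of-subset : ∀ k n i → i ≤ n → ∀ x →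
    -1ℤ ^ i * (+ ((k ∸ (n ∸ i)) C suc i) * (+ (k C (n ∸ i)) * (-1ℤ ^ (n ∸ i) * x)))
      ≡ - (+ (k C suc n) * -1ℤ ^ suc n) * (+ (suc n C suc i) * x)
  C-signed-subset-of-subset k n i i≤n x = begin
    -1ℤ ^ i * (+ C₁ * (+ C₂ * (-1ℤ ^ (n ∸ i) * x)))
      ≡⟨ regroup (-1ℤ ^ i) (+ C₁) (+ C₂) (-1ℤ ^ (n ∸ i)) x ⟩
    (+ C₂ * + C₁) * ((-1ℤ ^ i * -1ℤ ^ (n ∸ i)) * x)
      ≡⟨ cong₂ (λ c s → c * (s * x)) binomials signs ⟩
    (+ (k C suc n) * + (suc n C suc i)) * (- -1ℤ ^ suc n * x)
      ≡⟨ regroup′ (+ (k C suc n)) (+ (suc n C suc i)) (-1ℤ ^ suc n) x ⟩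
    - (+ (k C suc n) * -1ℤ ^ suc n) * (+ (suc n C suc i) * x)
      ∎
    where
    open ≡-Reasoning
    C₁ C₂ : ℕ
    C₁ = (k ∸ (n ∸ i)) C suc i
    C₂ = k C (n ∸ i)
    regroup : ∀ s c₁ c₂ t x → s * (c₁ * (c₂ * (t * x))) ≡ (c₂ * c₁) * ((s * t) * x)
    regroup = solve-∀
    regroup′ : ∀ c b s x → (c * b) * (- s * x) ≡ - (c * s) * (b * x)
    regroup′ = solve-∀
    binomials : + C₂ * + C₁ ≡ + (k C suc n) * + (suc n C suc i)
    binomials = trans (sym (ℤP.pos-* C₂ C₁))
      (trans (cong +_ (C-subset-of-subset k (suc n) (suc i) (s≤s i≤n))) (ℤP.pos-* (k C suc n) _))
    signs : -1ℤ ^ i * -1ℤ ^ (n ∸ i) ≡ - -1ℤ ^ suc n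
    signs = begin
      -1ℤ ^ i * -1ℤ ^ (n ∸ i)   ≡⟨ ℤP.^-distribˡ-+-* -1ℤ i (n ∸ i) ⟨
      -1ℤ ^ (i ℕ.+ (n ∸ i))     ≡⟨ cong (-1ℤ ^_) (ℕP.m+[n∸m]≡n i≤n) ⟩
      -1ℤ ^ n                   ≡⟨ ℤP.neg-involutive (-1ℤ ^ n) ⟨
      - - (-1ℤ ^ n)             ≡⟨ cong -_ (-1^suc n) ⟨
      - -1ℤ ^ suc n             ∎

  Poly : Set
  Poly = List ℤ

  infixl 6 _+ᴾ_
  _+ᴾ_ : Poly → Poly → Poly
  []      +ᴾ q       = q
  (a ∷ p) +ᴾ []      = a ∷ p
  (a ∷ p) +ᴾ (b ∷ q) = a + b ∷ p +ᴾ q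

  infixr 7 _·ᴾ_
  _·ᴾ_ : ℤ → Poly → Poly
  c ·ᴾ p = map (c *_) p

  X·_ : Poly → Poly
  X· p = 0ℤ ∷ p

  _[x-1] : Poly → Poly
  []      [x-1] = []
  (a ∷ p) [x-1] = (a ∷ []) +ᴾ X· (p [x-1]) +ᴾ -1ℤ ·ᴾ (p [x-1])

  eval-+ᴾ : ∀ p q x → evalPoly (p +ᴾ q) x ≡ evalPoly p x + evalPoly q x
  eval-+ᴾ []      q       x = sym (ℤP.+-identityˡ _)
  eval-+ᴾ (a ∷ p) []      x = sym (ℤP.+-identityʳ _)
  eval-+ᴾ (a ∷ p) (b ∷ q) x = trans (cong (λ s → a + b + x * s) (eval-+ᴾ p q x))
    (distribute a b x (evalPoly p x) (evalPoly q x))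
    where
    distribute : ∀ a b x s t → a + b + x * (s + t) ≡ (a + x * s) + (b + x * t)
    distribute = solve-∀

  eval-·ᴾ : ∀ c p x → evalPoly (c ·ᴾ p) x ≡ c * evalPoly p x
  eval-·ᴾ c []      x = sym (ℤP.*-zeroʳ c)
  eval-·ᴾ c (a ∷ p) x = trans (cong (λ s → c * a + x * s) (eval-·ᴾ c p x)) (distribute c a x (evalPoly p x))
    where
    distribute : ∀ c a x s → c * a + x * (c * s) ≡ c * (a + x * s)
    distribute = solve-∀

  eval-X· : ∀ p x → evalPoly (X· p) x ≡ x * evalPoly p x
  eval-X· p x = ℤP.+-identityˡ _

  eval-[x-1] : ∀ p x → evalPoly (p [x-1]) x ≡ evalPoly p (x - 1ℤ)
  eval-[x-1] []      x = refl
  eval-[x-1] (a ∷ p) x = begin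
    evalPoly ((a ∷ []) +ᴾ X· (p [x-1]) +ᴾ -1ℤ ·ᴾ (p [x-1])) x
      ≡⟨ eval-+ᴾ ((a ∷ []) +ᴾ X· (p [x-1])) (-1ℤ ·ᴾ (p [x-1])) x ⟩
    evalPoly ((a ∷ []) +ᴾ X· (p [x-1])) x + evalPoly (-1ℤ ·ᴾ (p [x-1])) x
      ≡⟨ cong₂ _+_ (trans (eval-+ᴾ (a ∷ []) (X· (p [x-1])) x) (cong (_+_ (evalPoly (a ∷ []) x)) (eval-X· (p [x-1]) x)))
                   (eval-·ᴾ -1ℤ (p [x-1]) x) ⟩
    evalPoly (a ∷ []) x + x * evalPoly (p [x-1]) x + -1ℤ * evalPoly (p [x-1]) x
      ≡⟨ cong (λ s → evalPoly (a ∷ []) x + x * s + -1ℤ * s) (eval-[x-1] p x) ⟩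
    (a + x * 0ℤ) + x * s + -1ℤ * s
      ≡⟨ collect a x s ⟩
    a + (x - 1ℤ) * s
      ∎
    where
    open ≡-Reasoning
    s : ℤ
    s = evalPoly p (x - 1ℤ)
    collect : ∀ a x s → (a + x * 0ℤ) + x * s + -1ℤ * s ≡ a + (x - 1ℤ) * s
    collect = solve-∀

  module ChromaticPolynomial (r : ℕ) where

    _‼_ : List Poly → ℕ → Poly
    []      ‼ i     = []
    (p ∷ _) ‼ zero  = p
    (_ ∷ h) ‼ suc i = h ‼ i

    -- history n = [P n, …, P 0] for P (n + 1) = x P n − C(n, r) x P (n − r) (x − 1),
    -- the recurrence obtained by differentiating the exponential generating function
    -- (∑_{j ≤ r} tʲ / j!)ˣ of the colourings. For n < r the lookup of P (n − r) runs off
    -- the list and returns [], harmlessly since C(n, r) = 0.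
    history : ℕ → List Poly
    history zero    = (1ℤ ∷ []) ∷ []
    history (suc n) = X· (history n ‼ 0) +ᴾ (- + (n C r)) ·ᴾ X· ((history n ‼ r) [x-1]) ∷ history n

    poly : ℕ → Poly
    poly n = history n ‼ 0

    history-‼ : ∀ i n → i ≤ n → history n ‼ i ≡ poly (n ∸ i)
    history-‼ zero    zero    _         = refl
    history-‼ zero    (suc n) _         = refl
    history-‼ (suc i) (suc n) (s≤s i≤n) = history-‼ i n i≤n

    χ : ℕ → ℤ → ℤ
    χ n = evalPoly (poly n)

    χ-zero : ∀ x → χ 0 x ≡ 1ℤ
    χ-zero x = cong (_+_ 1ℤ) (ℤP.*-zeroʳ x)

    χ-suc : ∀ n x → χ (suc n) x ≡ x * χ n x - + (n C r) * (x * χ (n ∸ r) (x - 1ℤ))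
    χ-suc n x = begin
      evalPoly (X· poly n +ᴾ c′ ·ᴾ X· (older [x-1])) x
        ≡⟨ eval-+ᴾ (X· poly n) (c′ ·ᴾ X· (older [x-1])) x ⟩
      evalPoly (X· poly n) x + evalPoly (c′ ·ᴾ X· (older [x-1])) x
        ≡⟨ cong₂ _+_ (eval-X· (poly n) x)
             (trans (eval-·ᴾ c′ (X· (older [x-1])) x) (cong (c′ *_) (eval-X· (older [x-1]) x))) ⟩
      x * χ n x + c′ * (x * evalPoly (older [x-1]) x)
        ≡⟨ cong (λ y → x * χ n x + c′ * (x * y)) (eval-[x-1] older x) ⟩
      x * χ n x + c′ * (x * evalPoly older (x - 1ℤ))
        ≡⟨ cong (_+_ (x * χ n x)) (trans (sym (ℤP.neg-distribˡ-* (+ (n C r)) _)) (cong -_ older-term)) ⟩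
      x * χ n x - + (n C r) * (x * χ (n ∸ r) (x - 1ℤ))
        ∎
      where
      open ≡-Reasoning
      c′ : ℤ
      c′ = - + (n C r)
      older : Poly
      older = history n ‼ r
      older-term : + (n C r) * (x * evalPoly older (x - 1ℤ)) ≡ + (n C r) * (x * χ (n ∸ r) (x - 1ℤ))
      older-term with ℕP.≤-<-connex r n
      ... | inj₁ r≤n = cong (λ p → + (n C r) * (x * evalPoly p (x - 1ℤ))) (history-‼ r n r≤n)
      ... | inj₂ n<r rewrite nCk≡0 n<r = refl

    χ-suc-at-0 : ∀ n → χ (suc n) 0ℤ ≡ 0ℤ
    χ-suc-at-0 n = trans (χ-suc n 0ℤ) (cong (_-_ 0ℤ) (ℤP.*-zeroʳ (+ (n C r))))

    colourSplit : ℕ → ℤ → ℤ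
    colourSplit n q = ∑[ j < suc r ] (+ (n C toℕ j) * χ (n ∸ toℕ j) q)

    χ-term : ∀ n q j → + (n C j) * χ (suc n ∸ j) q ≡
      q * (+ (n C j) * χ (n ∸ j) q) - (+ (n C r) * q) * (+ ((n ∸ r) C j) * χ (n ∸ r ∸ j) (q - 1ℤ))
    χ-term n q j with ℕP.≤-<-connex j n
    ... | inj₂ n<j rewrite nCk≡0 n<j | nCk≡0 (ℕP.≤-<-trans (ℕP.m∸n≤m n r) n<j) =
      vanish q (+ (n C r) * q)
      where
      vanish : ∀ q x → 0ℤ ≡ q * 0ℤ - x * 0ℤ
      vanish = solve-∀
    ... | inj₁ j≤n = begin
      nCj * χ (suc n ∸ j) q
        ≡⟨ cong (λ m → nCj * χ m q) (ℕP.+-∸-assoc 1 j≤n) ⟩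
      nCj * χ (suc (n ∸ j)) q
        ≡⟨ cong (nCj *_) (χ-suc (n ∸ j) q) ⟩
      nCj * (q * e - [n-j]Cr * (q * χ (n ∸ j ∸ r) (q - 1ℤ)))
        ≡⟨ cong (λ m → nCj * (q * e - [n-j]Cr * (q * χ m (q - 1ℤ)))) (∸-∸-comm n j r) ⟩
      nCj * (q * e - [n-j]Cr * (q * e′))
        ≡⟨ expand nCj [n-j]Cr q e e′ ⟩
      q * (nCj * e) - (nCj * [n-j]Cr) * (q * e′)
        ≡⟨ cong (λ x → q * (nCj * e) - x * (q * e′)) choose-twice ⟩
      q * (nCj * e) - (nCr * [n-r]Cj) * (q * e′)
        ≡⟨ regroup q nCj e nCr [n-r]Cj e′ ⟩
      q * (nCj * e) - (nCr * q) * ([n-r]Cj * e′)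
        ∎
      where
      open ≡-Reasoning
      nCj [n-j]Cr nCr [n-r]Cj e e′ : ℤ
      nCj = + (n C j)
      [n-j]Cr = + ((n ∸ j) C r)
      nCr = + (n C r)
      [n-r]Cj = + ((n ∸ r) C j)
      e = χ (n ∸ j) q
      e′ = χ (n ∸ r ∸ j) (q - 1ℤ)
      choose-twice : nCj * [n-j]Cr ≡ nCr * [n-r]Cj
      choose-twice = trans (sym (ℤP.pos-* (n C j) _)) (trans (cong +_ (C-choose-twice-comm n j r)) (ℤP.pos-* (n C r) _))
      expand : ∀ a b q e e′ → a * (q * e - b * (q * e′)) ≡ q * (a * e) - (a * b) * (q * e′)
      expand = solve-∀
      regroup : ∀ q a e c d e′ → q * (a * e) - (c * d) * (q * e′) ≡ q * (a * e) - (c * q) * (d * e′)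
      regroup = solve-∀

    colourSplit-zero : ∀ q → colourSplit 0 q ≡ 1ℤ
    colourSplit-zero q = cong₂ _+_ (trans (ℤP.*-identityˡ (χ 0 q)) (χ-zero q)) (∑-zero r (λ _ → refl))

    colourSplit-suc : ∀ n q → colourSplit (suc n) q ≡
      (q * colourSplit n q - (+ (n C r) * q) * colourSplit (n ∸ r) (q - 1ℤ)) + (colourSplit n q - + (n C r) * χ (n ∸ r) q)
    colourSplit-suc n q = trans (∑-pascal n r (λ j → χ (suc n ∸ j) q)) (cong₂ _+_ shifted unshifted)
      where
      shifted : ∑[ j < suc r ] (+ (n C toℕ j) * χ (suc n ∸ toℕ j) q) ≡
                q * colourSplit n q - (+ (n C r) * q) * colourSplit (n ∸ r) (q - 1ℤ)
      shifted = trans (∑-cong (suc r) (λ j → χ-term n q (toℕ j)))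
        (∑-linear (suc r) q (+ (n C r) * q) (λ j → + (n C toℕ j) * χ (n ∸ toℕ j) q)
                                           (λ j → + ((n ∸ r) C toℕ j) * χ (n ∸ r ∸ toℕ j) (q - 1ℤ)))
      unshifted : ∑[ j < r ] (+ (n C toℕ j) * χ (n ∸ toℕ j) q) ≡ colourSplit n q - + (n C r) * χ (n ∸ r) q
      unshifted = trans (add-sub _ (+ (n C r) * χ (n ∸ r) q))
        (cong (_- + (n C r) * χ (n ∸ r) q) (sym (∑-init-last r (λ j → + (n C j) * χ (n ∸ j) q))))
        where
        add-sub : ∀ x y → x ≡ x + y - y
        add-sub = solve-∀

    χ[q+1]≡colourSplit : ∀ n q → χ n (q + 1ℤ) ≡ colourSplit n q
    χ[q+1]≡colourSplit = <-rec _ step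
      where
      step : ∀ n → (∀ {m} → m < n → ∀ q → χ m (q + 1ℤ) ≡ colourSplit m q) →
             ∀ q → χ n (q + 1ℤ) ≡ colourSplit n q
      step zero    _  q = trans (χ-zero (q + 1ℤ)) (sym (colourSplit-zero q))
      step (suc n) ih q = begin
        χ (suc n) (q + 1ℤ)
          ≡⟨ χ-suc n (q + 1ℤ) ⟩
        (q + 1ℤ) * e - c * ((q + 1ℤ) * χ (n ∸ r) (q + 1ℤ - 1ℤ))
          ≡⟨ cong (λ x → (q + 1ℤ) * e - c * ((q + 1ℤ) * χ (n ∸ r) x)) (q+1-1≡q q) ⟩
        (q + 1ℤ) * e - c * ((q + 1ℤ) * e′)
          ≡⟨ split-q+1 q e c e′ ⟩
        (q * e - (c * q) * e′) + (e - c * e′)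
          ≡⟨ cong₂ (λ s t → (q * s - (c * q) * t) + (s - c * e′)) (ih (ℕP.n<1+n n) q)
               (trans (cong (χ (n ∸ r)) (sym (q-1+1≡q q))) (ih (s≤s (ℕP.m∸n≤m n r)) (q - 1ℤ))) ⟩
        (q * colourSplit n q - (c * q) * colourSplit (n ∸ r) (q - 1ℤ)) + (colourSplit n q - c * e′)
          ≡⟨ colourSplit-suc n q ⟨
        colourSplit (suc n) q
          ∎
        where
        open ≡-Reasoning
        c e e′ : ℤ
        c = + (n C r)
        e = χ n (q + 1ℤ)
        e′ = χ (n ∸ r) q
        q+1-1≡q : ∀ q → q + 1ℤ - 1ℤ ≡ q
        q+1-1≡q = solve-∀
        q-1+1≡q : ∀ q → q - 1ℤ + 1ℤ ≡ q
        q-1+1≡q = solve-∀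
        split-q+1 : ∀ q e c e′ → (q + 1ℤ) * e - c * ((q + 1ℤ) * e′) ≡ (q * e - (c * q) * e′) + (e - c * e′)
        split-q+1 = solve-∀

  bool-ext : ∀ {b c} → (b ≡ true → c ≡ true) → (c ≡ true → b ≡ true) → b ≡ c
  bool-ext {false} {false} _ _ = refl
  bool-ext {false} {true}  _ g = g refl
  bool-ext {true}  {_}     f _ = sym (f refl)

  all-cong : ∀ {p p′ : A → Bool} → (∀ x → p x ≡ p′ x) → ∀ xs → all p xs ≡ all p′ xs
  all-cong eq []       = refl
  all-cong eq (x ∷ xs) = cong₂ _∧_ (eq x) (all-cong eq xs)

  all-true : ∀ {p : A → Bool} → (∀ x → p x ≡ true) → ∀ xs → all p xs ≡ true
  all-true eq []       = refl
  all-true eq (x ∷ xs) rewrite eq x = all-true eq xs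

  all-true-∈ : ∀ {p : A → Bool} {x} xs → all p xs ≡ true → x ∈ xs → p x ≡ true
  all-true-∈ (y ∷ xs) h (here refl)  = proj₁ ∧-conical _ _ h
  all-true-∈ (y ∷ xs) h (there x∈xs) = all-true-∈ xs (proj₂ ∧-conical _ _ h) x∈xs

  all-allFin : ∀ {n} {p : Fin n → Bool} → (∀ i → p i ≡ true) → all p (allFinL n) ≡ true
  all-allFin {n} eq = all-true eq (allFinL n)

  all-allFin⁻ : ∀ {n} {p : Fin n → Bool} → all p (allFinL n) ≡ true → ∀ i → p i ≡ true
  all-allFin⁻ {n} h i = all-true-∈ (allFinL n) h (∈-allFin i)

  all-tabulate : ∀ n (f : Fin n → A) (p : A → Bool) → all p (tabulate f) ≡ all (λ i → p (f i)) (allFinL n)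
  all-tabulate zero    f p = refl
  all-tabulate (suc n) f p = cong (p (f Fin.zero) ∧_)
    (trans (all-tabulate n (λ i → f (Fin.suc i)) p) (sym (all-tabulate n Fin.suc (λ i → p (f i)))))

  all-mono : ∀ {p p′ : A → Bool} → (∀ x → p x ≡ true → p′ x ≡ true) → ∀ xs → all p xs ≡ true → all p′ xs ≡ true
  all-mono p⇒p′ []       _ = refl
  all-mono p⇒p′ (x ∷ xs) h = cong₂ _∧_ (p⇒p′ x (proj₁ ∧-conical _ _ h)) (all-mono p⇒p′ xs (proj₂ ∧-conical _ _ h))

  𝟙-all-∧ : ∀ (p p′ : A → Bool) xs → 𝟙 (all (λ x → p x ∧ p′ x) xs) ≡ 𝟙 (all p xs) * 𝟙 (all p′ xs)
  𝟙-all-∧ p p′ []       = refl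
  𝟙-all-∧ p p′ (x ∷ xs) = begin
    𝟙 ((p x ∧ p′ x) ∧ all (λ y → p y ∧ p′ y) xs)             ≡⟨ 𝟙-∧ (p x ∧ p′ x) _ ⟩
    𝟙 (p x ∧ p′ x) * 𝟙 (all (λ y → p y ∧ p′ y) xs)          ≡⟨ cong₂ _*_ (𝟙-∧ (p x) (p′ x)) (𝟙-all-∧ p p′ xs) ⟩
    (𝟙 (p x) * 𝟙 (p′ x)) * (𝟙 (all p xs) * 𝟙 (all p′ xs))   ≡⟨ interchange (𝟙 (p x)) _ _ _ ⟩
    (𝟙 (p x) * 𝟙 (all p xs)) * (𝟙 (p′ x) * 𝟙 (all p′ xs))   ≡⟨ cong₂ _*_ (𝟙-∧ (p x) _) (𝟙-∧ (p′ x) _) ⟨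
    𝟙 (p x ∧ all p xs) * 𝟙 (p′ x ∧ all p′ xs)                ∎
    where
    open ≡-Reasoning
    interchange : ∀ a b c d → (a * b) * (c * d) ≡ (a * c) * (b * d)
    interchange = solve-∀

  𝟙-all-++ : ∀ (p : A → Bool) xs ys → 𝟙 (all p (xs ++ ys)) ≡ 𝟙 (all p xs) * 𝟙 (all p ys)
  𝟙-all-++ p []       ys = sym (ℤP.*-identityˡ _)
  𝟙-all-++ p (x ∷ xs) ys = begin
    𝟙 (p x ∧ all p (xs ++ ys))              ≡⟨ 𝟙-∧ (p x) _ ⟩
    𝟙 (p x) * 𝟙 (all p (xs ++ ys))          ≡⟨ cong (𝟙 (p x) *_) (𝟙-all-++ p xs ys) ⟩
    𝟙 (p x) * (𝟙 (all p xs) * 𝟙 (all p ys)) ≡⟨ ℤP.*-assoc (𝟙 (p x)) _ _ ⟨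
    𝟙 (p x) * 𝟙 (all p xs) * 𝟙 (all p ys)   ≡⟨ cong (_* 𝟙 (all p ys)) (𝟙-∧ (p x) _) ⟨
    𝟙 (p x ∧ all p xs) * 𝟙 (all p ys)       ∎
    where open ≡-Reasoning

  ≤ᵇ-suc : ∀ m n → (suc m ≤ᵇ suc n) ≡ (m ≤ᵇ n)
  ≤ᵇ-suc zero    n = refl
  ≤ᵇ-suc (suc m) n = refl

  ≤ᵇ-true : ∀ {m n} → m ≤ n → (m ≤ᵇ n) ≡ true
  ≤ᵇ-true m≤n = Equivalence.to T-≡ (ℕP.≤⇒≤ᵇ m≤n)

  ≤ᵇ-false : ∀ {m n} → n < m → (m ≤ᵇ n) ≡ false
  ≤ᵇ-false {m} {n} n<m = ¬-not (λ m≤ᵇn → ℕP.<⇒≱ n<m (ℕP.≤ᵇ⇒≤ m n (Equivalence.from T-≡ m≤ᵇn)))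

  <ᵇ-trans : ∀ x y z → (x <ᵇ y) ≡ true → (y <ᵇ z) ≡ true → (x <ᵇ z) ≡ true
  <ᵇ-trans x y z x<y y<z = Equivalence.to T-≡ (ℕP.<⇒<ᵇ (ℕP.<-trans (ℕP.<ᵇ⇒< x y (Equivalence.from T-≡ x<y))
                                                                   (ℕP.<ᵇ⇒< y z (Equivalence.from T-≡ y<z))))

  <ᵇ⇒≢ : ∀ x y → (x <ᵇ y) ≡ true → not ⌊ x ℕ.≟ y ⌋ ≡ true
  <ᵇ⇒≢ x y x<y with x ℕ.≟ y
  ... | yes refl = ⊥-elim (ℕP.<-irrefl refl (ℕP.<ᵇ⇒< x x (Equivalence.from T-≡ x<y)))
  ... | no  _    = refl

  ⌊x≟x⌋ : ∀ {n} (x : Fin n) → ⌊ x Fin.≟ x ⌋ ≡ true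
  ⌊x≟x⌋ x = trans (isYes≗does (x Fin.≟ x)) (dec-true (x Fin.≟ x) refl)

  ⌊suc≟suc⌋ : ∀ {n} (x y : Fin n) → ⌊ Fin.suc x Fin.≟ Fin.suc y ⌋ ≡ ⌊ x Fin.≟ y ⌋
  ⌊suc≟suc⌋ x y = ⌊⌋-map′ (cong Fin.suc) FinP.suc-injective (x Fin.≟ y)

  ∑-lookup : ∀ {n} (c : Vec A n) (f : A → ℤ) → ∑[ u < n ] f (lookup c u) ≡ ∑[ x ∈ toList c ] f x
  ∑-lookup []      f = refl
  ∑-lookup (x ∷ c) f = cong (_+_ (f x)) (∑-lookup c f)

  ∑-except : ∀ {n} (v : Fin n) (f : Fin n → ℤ) →
    ∑[ u < n ] f u ≡ f v + ∑[ u < n ] (𝟙 (not ⌊ v Fin.≟ u ⌋) * f u)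
  ∑-except {suc n} Fin.zero f =
    cong (_+_ (f Fin.zero)) (sym (trans (ℤP.+-identityˡ _) (∑-cong n (λ u → ℤP.*-identityˡ (f (Fin.suc u))))))
  ∑-except {suc n} (Fin.suc v) f = begin
    f Fin.zero + ∑[ u < n ] f (Fin.suc u)
      ≡⟨ cong (_+_ (f Fin.zero)) (∑-except v (λ u → f (Fin.suc u))) ⟩
    f Fin.zero + (f (Fin.suc v) + rest)
      ≡⟨ swap (f Fin.zero) (f (Fin.suc v)) rest ⟩
    f (Fin.suc v) + (1ℤ * f Fin.zero + rest)
      ≡⟨ cong (λ x → f (Fin.suc v) + (1ℤ * f Fin.zero + x))
           (∑-cong n (λ u → cong (λ b → 𝟙 (not b) * f (Fin.suc u)) (sym (⌊suc≟suc⌋ v u)))) ⟩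
    f (Fin.suc v) + ∑[ u < suc n ] (𝟙 (not ⌊ Fin.suc v Fin.≟ u ⌋) * f u)
      ∎
    where
    open ≡-Reasoning
    rest : ℤ
    rest = ∑[ u < n ] (𝟙 (not ⌊ v Fin.≟ u ⌋) * f (Fin.suc u))
    swap : ∀ a b c → a + (b + c) ≡ b + (1ℤ * a + c)
    swap = solve-∀

  occurrences : ∀ {q} → Fin q → List (Fin q) → ℕ
  occurrences c = count (λ x → ⌊ x Fin.≟ c ⌋)

  eachAtMost : ∀ {q} → ℕ → List (Fin q) → Bool
  eachAtMost {q} r l = all (λ c → occurrences c l ≤ᵇ r) (allFinL q)

  suc-neighbours≡occurrences : ∀ {n q} (c : Vec (Fin q) n) v →
    suc (count (λ u → K n v u ∧ ⌊ lookup c u Fin.≟ lookup c v ⌋) (allFinL n)) ≡ occurrences (lookup c v) (toList c)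
  suc-neighbours≡occurrences {n} c v = ℤP.+-injective (begin
    + suc (count (λ u → K n v u ∧ same u) (allFinL n))
      ≡⟨ ℤP.pos-+ 1 _ ⟩
    1ℤ + + count (λ u → K n v u ∧ same u) (allFinL n)
      ≡⟨ cong₂ _+_ (cong 𝟙 (sym (⌊x≟x⌋ (lookup c v))))
           (trans (count≡sumOver _ (allFinL n)) (sumOver-allFin n (λ u → 𝟙 (K n v u ∧ same u)))) ⟩
    𝟙 (same v) + ∑[ u < n ] 𝟙 (K n v u ∧ same u)
      ≡⟨ cong (_+_ (𝟙 (same v))) (∑-cong n (λ u → 𝟙-∧ (K n v u) (same u))) ⟩
    𝟙 (same v) + ∑[ u < n ] (𝟙 (K n v u) * 𝟙 (same u))
      ≡⟨ sym (∑-except v (λ u → 𝟙 (same u))) ⟩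
    ∑[ u < n ] 𝟙 (same u)
      ≡⟨ ∑-lookup c (λ x → 𝟙 ⌊ x Fin.≟ lookup c v ⌋) ⟩
    ∑[ x ∈ toList c ] 𝟙 ⌊ x Fin.≟ lookup c v ⌋
      ≡⟨ sym (count≡sumOver _ (toList c)) ⟩
    + occurrences (lookup c v) (toList c)
      ∎)
    where
    open ≡-Reasoning
    same : Fin n → Bool
    same u = ⌊ lookup c u Fin.≟ lookup c v ⌋

  occurrences≢0⇒lookup : ∀ {n q} (c : Vec (Fin q) n) col → occurrences col (toList c) ≢ 0 → ∃ λ v → lookup c v ≡ col
  occurrences≢0⇒lookup []      col none = ⊥-elim (none refl)
  occurrences≢0⇒lookup (x ∷ c) col some with x Fin.≟ col
  ... | yes x≡col = Fin.zero , x≡col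
  ... | no  _     = let v , eq = occurrences≢0⇒lookup c col some in Fin.suc v , eq

  admissible-K : ∀ r n q (c : Vec (Fin q) n) → admissible (suc r) (K n) c ≡ eachAtMost (suc r) (toList c)
  admissible-K r n q c = trans (all-cong bound (allFinL n)) (bool-ext positions⇒colours colours⇒positions)
    where
    l : List (Fin q)
    l = toList c
    bound : ∀ v → (count (λ u → K n v u ∧ ⌊ lookup c u Fin.≟ lookup c v ⌋) (allFinL n) ≤ᵇ r)
                ≡ (occurrences (lookup c v) l ≤ᵇ suc r)
    bound v = trans (sym (≤ᵇ-suc (count (λ u → K n v u ∧ ⌊ lookup c u Fin.≟ lookup c v ⌋) (allFinL n)) r))
                    (cong (_≤ᵇ suc r) (suc-neighbours≡occurrences c v))
    positions⇒colours : all (λ v → occurrences (lookup c v) l ≤ᵇ suc r) (allFinL n) ≡ true →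
                        eachAtMost (suc r) l ≡ true
    positions⇒colours h = all-allFin colour-ok
      where
      colour-ok : ∀ col → (occurrences col l ≤ᵇ suc r) ≡ true
      colour-ok col with occurrences col l ℕ.≟ 0
      ... | yes none = cong (_≤ᵇ suc r) none
      ... | no  some = let v , cv≡col = occurrences≢0⇒lookup c col some in
        subst (λ x → (occurrences x l ≤ᵇ suc r) ≡ true) cv≡col (all-allFin⁻ h v)
    colours⇒positions : eachAtMost (suc r) l ≡ true →
                        all (λ v → occurrences (lookup c v) l ≤ᵇ suc r) (allFinL n) ≡ true
    colours⇒positions h = all-allFin (λ v → all-allFin⁻ h (lookup c v))

  colourings : ℕ → ℕ → ℕ → ℤ
  colourings r n q = ∑[ w ∈ allVecs n q ] 𝟙 (eachAtMost r (toList w))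

  chiCount-K≡colourings : ∀ r n q → 1 ≤ r → + chiCount r (K n) q ≡ colourings r n q
  chiCount-K≡colourings (suc r) n q _ = trans (count≡sumOver (admissible (suc r) (K n)) (allVecs n q))
    (sumOver-cong (allVecs n q) (λ c → cong 𝟙 (admissible-K r n q c)))

  strip₀ : ∀ {q} → List (Fin (suc q)) → List (Fin q)
  strip₀ []              = []
  strip₀ (Fin.zero  ∷ l) = strip₀ l
  strip₀ (Fin.suc c ∷ l) = c ∷ strip₀ l

  occurrences-strip₀ : ∀ {q} (c : Fin q) l → occurrences (Fin.suc c) l ≡ occurrences c (strip₀ l)
  occurrences-strip₀ c []              = refl
  occurrences-strip₀ c (Fin.zero  ∷ l) = occurrences-strip₀ c l
  occurrences-strip₀ c (Fin.suc x ∷ l) rewrite ⌊suc≟suc⌋ x c with ⌊ x Fin.≟ c ⌋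
  ... | true  = cong suc (occurrences-strip₀ c l)
  ... | false = occurrences-strip₀ c l

  eachAtMost-suc : ∀ {q} r (l : List (Fin (suc q))) →
    eachAtMost r l ≡ (occurrences Fin.zero l ≤ᵇ r) ∧ eachAtMost r (strip₀ l)
  eachAtMost-suc {q} r l = cong ((occurrences Fin.zero l ≤ᵇ r) ∧_)
    (trans (all-tabulate q Fin.suc (λ c → occurrences c l ≤ᵇ r))
           (all-cong (λ c → cong (_≤ᵇ r) (occurrences-strip₀ c l)) (allFinL q)))

  sumOver-allVecs-colour₀ : ∀ {q} n (F : Vec (Fin (suc q)) (suc n) → ℤ) →
    ∑[ w ∈ allVecs (suc n) (suc q) ] F w ≡
    ∑[ w ∈ allVecs n (suc q) ] F (Fin.zero ∷ w) + ∑[ c < q ] ∑[ w ∈ allVecs n (suc q) ] F (Fin.suc c ∷ w)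
  sumOver-allVecs-colour₀ {q} n F =
    trans (sumOver-allVecs-suc n (suc q) F)
    (trans (sumOver-distrib-+ (allVecs n (suc q)) (λ w → F (Fin.zero ∷ w)) (λ w → ∑[ c < q ] F (Fin.suc c ∷ w)))
           (cong (_+_ (∑[ w ∈ allVecs n (suc q) ] F (Fin.zero ∷ w)))
                 (sumOver-comm-∑ (allVecs n (suc q)) q (λ w c → F (Fin.suc c ∷ w)))))

  ∑-colour₀ : ∀ {q} n j (Φ : List (Fin q) → ℤ) →
    ∑[ w ∈ allVecs n (suc q) ] (𝟙 (occurrences Fin.zero (toList w) ℕ.≡ᵇ j) * Φ (strip₀ (toList w)))
      ≡ + (n C j) * ∑[ u ∈ allVecs (n ∸ j) q ] Φ (toList u)
  ∑-colour₀ zero    zero    Φ = unit (Φ [])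
    where
    unit : ∀ x → 1ℤ * x + 0ℤ ≡ 1ℤ * (x + 0ℤ)
    unit = solve-∀
  ∑-colour₀ zero    (suc j) Φ = refl
  ∑-colour₀ {q} (suc n) j Φ = begin
    ∑[ w ∈ allVecs (suc n) (suc q) ] F w
      ≡⟨ sumOver-allVecs-colour₀ n F ⟩
    ∑[ w ∈ allVecs n (suc q) ] F (Fin.zero ∷ w) + ∑[ c < q ] ∑[ w ∈ allVecs n (suc q) ] F (Fin.suc c ∷ w)
      ≡⟨ cong (_+_ (∑[ w ∈ allVecs n (suc q) ] F (Fin.zero ∷ w))) other-colours ⟩
    ∑[ w ∈ allVecs n (suc q) ] F (Fin.zero ∷ w) + + (n C j) * V (suc (n ∸ j))
      ≡⟨ colour₀-first j ⟩
    + (suc n C j) * V (suc n ∸ j)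
      ∎
    where
    open ≡-Reasoning
    F : Vec (Fin (suc q)) (suc n) → ℤ
    F w = 𝟙 (occurrences Fin.zero (toList w) ℕ.≡ᵇ j) * Φ (strip₀ (toList w))
    V : ℕ → ℤ
    V m = ∑[ u ∈ allVecs m q ] Φ (toList u)
    other-colours : ∑[ c < q ] ∑[ w ∈ allVecs n (suc q) ] F (Fin.suc c ∷ w) ≡ + (n C j) * V (suc (n ∸ j))
    other-colours = begin
      ∑[ c < q ] ∑[ w ∈ allVecs n (suc q) ] F (Fin.suc c ∷ w)
        ≡⟨ ∑-cong q (λ c → ∑-colour₀ n j (λ l → Φ (c ∷ l))) ⟩
      ∑[ c < q ] (+ (n C j) * ∑[ u ∈ allVecs (n ∸ j) q ] Φ (c ∷ toList u))
        ≡⟨ *-distribˡ-sum {q} (+ (n C j)) (λ c → ∑[ u ∈ allVecs (n ∸ j) q ] Φ (c ∷ toList u)) ⟨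
      + (n C j) * ∑[ c < q ] ∑[ u ∈ allVecs (n ∸ j) q ] Φ (c ∷ toList u)
        ≡⟨ cong (+ (n C j) *_) (sym (trans (sumOver-allVecs-suc (n ∸ j) q (λ u → Φ (toList u)))
                                       (sumOver-comm-∑ (allVecs (n ∸ j) q) q (λ u c → Φ (c ∷ toList u))))) ⟩
      + (n C j) * V (suc (n ∸ j))
        ∎
    colour₀-first : ∀ j → ∑[ w ∈ allVecs n (suc q) ] (𝟙 (suc (occurrences Fin.zero (toList w)) ℕ.≡ᵇ j) * Φ (strip₀ (toList w)))
                          + + (n C j) * V (suc (n ∸ j)) ≡ + (suc n C j) * V (suc n ∸ j)
    colour₀-first zero    = trans (cong (_+ 1ℤ * V (suc n)) (sumOver-zero (allVecs n (suc q)) (λ _ → refl)))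
                                  (ℤP.+-identityˡ _)
    colour₀-first (suc j) = trans (cong (_+ + (n C suc j) * V (suc (n ∸ suc j))) (∑-colour₀ n j Φ))
                                  (pascal-weighted n j V)

  𝟙-≤ᵇ : ∀ t r → 𝟙 (t ≤ᵇ r) ≡ ∑[ j < suc r ] 𝟙 (t ℕ.≡ᵇ toℕ j)
  𝟙-≤ᵇ zero    r       = cong (_+_ 1ℤ) (sym (∑-zero r (λ _ → refl)))
  𝟙-≤ᵇ (suc t) zero    = refl
  𝟙-≤ᵇ (suc t) (suc r) = trans (cong 𝟙 (≤ᵇ-suc t r)) (trans (𝟙-≤ᵇ t r) (sym (ℤP.+-identityˡ _)))

  colourings-suc : ∀ r n q → colourings r n (suc q) ≡ ∑[ j < suc r ] (+ (n C toℕ j) * colourings r (n ∸ toℕ j) q)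
  colourings-suc r n q = begin
    ∑[ w ∈ allVecs n (suc q) ] 𝟙 (eachAtMost r (toList w))
      ≡⟨ sumOver-cong (allVecs n (suc q)) split ⟩
    ∑[ w ∈ allVecs n (suc q) ] ∑[ j < suc r ] (𝟙 (occurrences Fin.zero (toList w) ℕ.≡ᵇ toℕ j) * rest w)
      ≡⟨ sumOver-comm-∑ (allVecs n (suc q)) (suc r) (λ w j → 𝟙 (occurrences Fin.zero (toList w) ℕ.≡ᵇ toℕ j) * rest w) ⟩
    ∑[ j < suc r ] ∑[ w ∈ allVecs n (suc q) ] (𝟙 (occurrences Fin.zero (toList w) ℕ.≡ᵇ toℕ j) * rest w)
      ≡⟨ ∑-cong (suc r) (λ j → ∑-colour₀ n (toℕ j) (λ (l : List (Fin q)) → 𝟙 (eachAtMost r l))) ⟩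
    ∑[ j < suc r ] (+ (n C toℕ j) * colourings r (n ∸ toℕ j) q)
      ∎
    where
    open ≡-Reasoning
    rest : Vec (Fin (suc q)) n → ℤ
    rest w = 𝟙 (eachAtMost r (strip₀ (toList w)))
    split : ∀ w → 𝟙 (eachAtMost r (toList w)) ≡ ∑[ j < suc r ] (𝟙 (occurrences Fin.zero (toList w) ℕ.≡ᵇ toℕ j) * rest w)
    split w = begin
      𝟙 (eachAtMost r (toList w))
        ≡⟨ cong 𝟙 (eachAtMost-suc r (toList w)) ⟩
      𝟙 ((occurrences Fin.zero (toList w) ≤ᵇ r) ∧ eachAtMost r (strip₀ (toList w)))
        ≡⟨ 𝟙-∧ (occurrences Fin.zero (toList w) ≤ᵇ r) _ ⟩
      𝟙 (occurrences Fin.zero (toList w) ≤ᵇ r) * rest w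
        ≡⟨ cong (_* rest w) (𝟙-≤ᵇ (occurrences Fin.zero (toList w)) r) ⟩
      ∑[ j < suc r ] 𝟙 (occurrences Fin.zero (toList w) ℕ.≡ᵇ toℕ j) * rest w
        ≡⟨ *-distribʳ-sum {suc r} (rest w) (λ j → 𝟙 (occurrences Fin.zero (toList w) ℕ.≡ᵇ toℕ j)) ⟩
      ∑[ j < suc r ] (𝟙 (occurrences Fin.zero (toList w) ℕ.≡ᵇ toℕ j) * rest w)
        ∎

  colourings-empty : ∀ r q → colourings r 0 q ≡ 1ℤ
  colourings-empty r q = cong (λ b → 𝟙 b + 0ℤ) (all-true (λ _ → refl) (allFinL q))

  colourings-no-colours : ∀ r n → colourings r (suc n) 0 ≡ 0ℤ
  colourings-no-colours r n =
    trans (sumOver-allVecs-suc n 0 (λ w → 𝟙 (eachAtMost r (toList w)))) (sumOver-zero (allVecs n 0) (λ _ → refl))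

  module _ (r : ℕ) where
    open ChromaticPolynomial r

    χ≡colourings : ∀ q n → χ n (+ q) ≡ colourings r n q
    χ≡colourings zero    zero    = trans (χ-zero 0ℤ) (sym (colourings-empty r 0))
    χ≡colourings zero    (suc n) = trans (χ-suc-at-0 n) (sym (colourings-no-colours r n))
    χ≡colourings (suc q) n = begin
      χ n (+ suc q)                                                ≡⟨ cong (χ n) (trans (cong +_ (ℕP.+-comm 1 q)) (ℤP.pos-+ q 1)) ⟩
      χ n (+ q + 1ℤ)                                               ≡⟨ χ[q+1]≡colourSplit n (+ q) ⟩
      ∑[ j < suc r ] (+ (n C toℕ j) * χ (n ∸ toℕ j) (+ q))         ≡⟨ ∑-cong (suc r) (λ j → cong (+ (n C toℕ j) *_) (χ≡colourings q (n ∸ toℕ j))) ⟩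
      ∑[ j < suc r ] (+ (n C toℕ j) * colourings r (n ∸ toℕ j) q)  ≡⟨ colourings-suc r n q ⟨
      colourings r n (suc q)                                       ∎
      where open ≡-Reasoning

  firstRun : ℕ → List ℕ → ℕ
  firstRun p []       = 0
  firstRun p (y ∷ ys) = if p <ᵇ y then suc (firstRun y ys) else 0

  -- The local function `go` of `runLengths` cannot be named outside `Defs`. The metavariable
  -- `runsFrom` is solved to `λ x xs → go` by unification in `runLengths-∷∷`, whose `with`
  -- abstractions turn the arguments of `go` into distinct variables.
  mutual
    runsFrom : ℕ → List ℕ → ℕ → ℕ → List ℕ → List ℕ
    runsFrom = _

    runLengths-∷∷ : ∀ x y ys → runLengths (x ∷ y ∷ ys) ≡
      (if x <ᵇ y then runsFrom x (y ∷ ys) y 2 ys else 1 ∷ runsFrom x (y ∷ ys) y 1 ys)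
    runLengths-∷∷ x y ys with x <ᵇ y
    ... | false = refl
    ... | true with y ∷ ys
    ...   | _ with x | y | 2 | ys
    ...     | _ | _ | _ | _ = refl

  runsFrom-firstRun : ∀ x xs p n l → runsFrom x xs p n l ≡ (n ℕ.+ firstRun p l) ∷ runLengths (drop (firstRun p l) l)
  runsFrom-firstRun x xs p n []       = cong (_∷ []) (sym (ℕP.+-identityʳ n))
  runsFrom-firstRun x xs p n (y ∷ ys) with p <ᵇ y
  ... | true  = trans (runsFrom-firstRun x xs y (suc n) ys)
                      (cong (_∷ runLengths (drop (firstRun y ys) ys)) (sym (ℕP.+-suc n (firstRun y ys))))
  ... | false = cong₂ _∷_ (sym (ℕP.+-identityʳ n))
                      (trans (runsFrom-firstRun x xs y 1 ys) (sym (runsFrom-firstRun y ys y 1 ys)))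

  runLengths-∷ : ∀ x l → runLengths (x ∷ l) ≡ suc (firstRun x l) ∷ runLengths (drop (firstRun x l) l)
  runLengths-∷ x []       = refl
  runLengths-∷ x (y ∷ ys) with x <ᵇ y | runLengths-∷∷ x y ys
  ... | true  | unfold = trans unfold (runsFrom-firstRun x (y ∷ ys) y 2 ys)
  ... | false | unfold = trans unfold (cong (1 ∷_)
    (trans (runsFrom-firstRun x (y ∷ ys) y 1 ys) (sym (runsFrom-firstRun y ys y 1 ys))))

  goodRuns : ℕ → List ℕ → Bool
  goodRuns d xs = all (goodLen d) (runLengths xs)

  goodRuns-∷ : ∀ d x l →
    𝟙 (goodRuns d (x ∷ l)) ≡ 𝟙 (goodLen d (suc (firstRun x l))) * 𝟙 (goodRuns d (drop (firstRun x l) l))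
  goodRuns-∷ d x l = trans (cong (λ ls → 𝟙 (all (goodLen d) ls)) (runLengths-∷ x l))
    (𝟙-∧ (goodLen d (suc (firstRun x l))) (goodRuns d (drop (firstRun x l) l)))

  ascending : List ℕ → Bool
  ascending []          = true
  ascending (x ∷ [])    = true
  ascending (x ∷ y ∷ l) = (x <ᵇ y) ∧ ascending (y ∷ l)

  module Runs (d : ℕ) where

    peeled : ℕ → List ℕ → ℤ
    peeled p xs = 𝟙 ((p ≤ᵇ length xs) ∧ ascending (take p xs)) * 𝟙 (goodRuns d (drop p xs))

    peelSum : ℕ → List ℕ → ℤ
    peelSum k xs = ∑[ i < k ] (-1ℤ ^ toℕ i * peeled (suc (toℕ i)) xs)

    peeled-∷∷ : ∀ i x y l → peeled (suc (suc i)) (x ∷ y ∷ l) ≡ 𝟙 (x <ᵇ y) * peeled (suc i) (y ∷ l)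
    peeled-∷∷ i x y l = begin
      𝟙 (long ∧ ((x <ᵇ y) ∧ asc)) * rest
        ≡⟨ cong (_* rest) (trans (𝟙-∧ long _) (cong (𝟙 long *_) (𝟙-∧ (x <ᵇ y) asc))) ⟩
      𝟙 long * (𝟙 (x <ᵇ y) * 𝟙 asc) * rest
        ≡⟨ regroup (𝟙 long) (𝟙 (x <ᵇ y)) (𝟙 asc) rest ⟩
      𝟙 (x <ᵇ y) * (𝟙 long * 𝟙 asc * rest)
        ≡⟨ cong (λ z → 𝟙 (x <ᵇ y) * (z * rest)) (sym (𝟙-∧ long asc)) ⟩
      𝟙 (x <ᵇ y) * peeled (suc i) (y ∷ l)
        ∎
      where
      open ≡-Reasoning
      long asc : Bool
      long = suc i ≤ᵇ suc (length l)
      asc = ascending (y ∷ take i l)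
      rest : ℤ
      rest = 𝟙 (goodRuns d (drop i l))
      regroup : ∀ a b c z → a * (b * c) * z ≡ b * (a * c * z)
      regroup = solve-∀

    peelSum-∷∷ : ∀ k x y l → peelSum (suc k) (x ∷ y ∷ l) ≡ 𝟙 (goodRuns d (y ∷ l)) - 𝟙 (x <ᵇ y) * peelSum k (y ∷ l)
    peelSum-∷∷ k x y l = cong₂ _+_
      (trans (ℤP.*-identityˡ (1ℤ * 𝟙 (goodRuns d (y ∷ l)))) (ℤP.*-identityˡ (𝟙 (goodRuns d (y ∷ l)))))
      (begin
        ∑[ i < k ] (-1ℤ ^ suc (toℕ i) * peeled (suc (suc (toℕ i))) (x ∷ y ∷ l))
          ≡⟨ ∑-cong k (λ i → cong (-1ℤ ^ suc (toℕ i) *_) (peeled-∷∷ (toℕ i) x y l)) ⟩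
        ∑[ i < k ] (-1ℤ ^ suc (toℕ i) * (𝟙 (x <ᵇ y) * peeled (suc (toℕ i)) (y ∷ l)))
          ≡⟨ ∑-sign-suc k (λ i → 𝟙 (x <ᵇ y) * peeled (suc i) (y ∷ l)) ⟩
        - ∑[ i < k ] (-1ℤ ^ toℕ i * (𝟙 (x <ᵇ y) * peeled (suc (toℕ i)) (y ∷ l)))
          ≡⟨ cong -_ (trans (∑-cong k (λ i → pull (-1ℤ ^ toℕ i) (𝟙 (x <ᵇ y)) _))
                            (sym (*-distribˡ-sum {k} (𝟙 (x <ᵇ y)) (λ i → -1ℤ ^ toℕ i * peeled (suc (toℕ i)) (y ∷ l))))) ⟩
        - (𝟙 (x <ᵇ y) * peelSum k (y ∷ l))
          ∎)
      where
      open ≡-Reasoning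
      pull : ∀ s b p → s * (b * p) ≡ b * (s * p)
      pull = solve-∀

    peelSum-[x] : ∀ k x → peelSum (suc k) (x ∷ []) ≡ 1ℤ
    peelSum-[x] k x = cong (_+_ 1ℤ) (∑-zero k (λ i → ℤP.*-zeroʳ (-1ℤ ^ suc (toℕ i))))

    goodLen-0 : goodLen d 0 ≡ true
    goodLen-0 = cong (_∨ ⌊ d ∣? 0 ⌋) (trans (isYes≗does (d ∣? 0)) (dec-true (d ∣? 0) (d ∣0)))

    goodLen-1 : goodLen d 1 ≡ true
    goodLen-1 = trans (cong (⌊ d ∣? 1 ⌋ ∨_) (trans (isYes≗does (d ∣? 0)) (dec-true (d ∣? 0) (d ∣0))))
                      (∨-zeroʳ ⌊ d ∣? 1 ⌋)

    ⌊d∣?d+M⌋ : ∀ M → ⌊ d ∣? d ℕ.+ M ⌋ ≡ ⌊ d ∣? M ⌋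
    ⌊d∣?d+M⌋ M = trans (isYes≗does (d ∣? d ℕ.+ M)) (trans
      (does-⇔ (mk⇔ (λ d∣d+M → ∣m+n∣m⇒∣n d∣d+M ∣-refl) (∣m∣n⇒∣m+n ∣-refl)) (d ∣? d ℕ.+ M) (d ∣? M))
      (sym (isYes≗does (d ∣? M))))

    goodLen-shift : ∀ M → goodLen d (d ℕ.+ M) ≡ goodLen d M
    goodLen-shift zero    = trans (cong (goodLen d) (ℕP.+-identityʳ d))
      (trans (cong (_∨ ⌊ d ∣? d ∸ 1 ⌋) (trans (isYes≗does (d ∣? d)) (dec-true (d ∣? d) ∣-refl))) (sym goodLen-0))
    goodLen-shift (suc M) = cong₂ _∨_ (⌊d∣?d+M⌋ (suc M))
      (trans (cong (λ n → ⌊ d ∣? n ∸ 1 ⌋) (ℕP.+-suc d M)) (⌊d∣?d+M⌋ M))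

    goodLen-short : ∀ N → suc (suc N) < d → goodLen d (suc (suc N)) ≡ false
    goodLen-short N N+2<d = cong₂ _∨_ (not-divisible (suc (suc N)) N+2<d) (not-divisible (suc N) (ℕP.<-trans (ℕP.n<1+n _) N+2<d))
      where
      not-divisible : ∀ n → .{{ℕ.NonZero n}} → n < d → ⌊ d ∣? n ⌋ ≡ false
      not-divisible n n<d = trans (isYes≗does (d ∣? n)) (dec-false (d ∣? n) (>⇒∤ n<d))

    goodLen-periodic : ∀ N → 𝟙 (goodLen d (suc (suc N))) ≡ 𝟙 (d ≤ᵇ suc (suc N)) * 𝟙 (goodLen d (suc (suc N) ∸ d))
    goodLen-periodic N with ℕP.≤-<-connex d (suc (suc N))
    ... | inj₁ d≤N+2 = begin
      𝟙 (goodLen d (suc (suc N)))                         ≡⟨ cong (λ n → 𝟙 (goodLen d n)) (ℕP.m+[n∸m]≡n d≤N+2) ⟨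
      𝟙 (goodLen d (d ℕ.+ (suc (suc N) ∸ d)))              ≡⟨ cong 𝟙 (goodLen-shift (suc (suc N) ∸ d)) ⟩
      𝟙 (goodLen d (suc (suc N) ∸ d))                     ≡⟨ ℤP.*-identityˡ _ ⟨
      1ℤ * 𝟙 (goodLen d (suc (suc N) ∸ d))                ≡⟨ cong (λ b → 𝟙 b * 𝟙 (goodLen d (suc (suc N) ∸ d))) (≤ᵇ-true d≤N+2) ⟨
      𝟙 (d ≤ᵇ suc (suc N)) * 𝟙 (goodLen d (suc (suc N) ∸ d)) ∎
      where open ≡-Reasoning
    ... | inj₂ N+2<d = trans (cong 𝟙 (goodLen-short N N+2<d))
      (cong (λ b → 𝟙 b * 𝟙 (goodLen d (suc (suc N) ∸ d))) (sym (≤ᵇ-false N+2<d)))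

    peelSumRun : ℕ → ℕ → ℤ
    peelSumRun L k = ∑[ i < k ] (-1ℤ ^ toℕ i * (𝟙 (toℕ i <ᵇ L) * 𝟙 (goodLen d (L ∸ suc (toℕ i)))))

    peelSumRun-zero : ∀ k → peelSumRun 0 k ≡ 0ℤ
    peelSumRun-zero k = ∑-zero k (λ i → ℤP.*-zeroʳ (-1ℤ ^ toℕ i))

    peelSumRun-suc : ∀ L k → peelSumRun (suc L) (suc k) ≡ 𝟙 (goodLen d L) - peelSumRun L k
    peelSumRun-suc L k = cong₂ _+_ (trans (ℤP.*-identityˡ (1ℤ * 𝟙 (goodLen d L))) (ℤP.*-identityˡ (𝟙 (goodLen d L))))
      (∑-sign-suc k (λ i → 𝟙 (i <ᵇ L) * 𝟙 (goodLen d (L ∸ suc i))))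

    peelSumRun-one : ∀ k → peelSumRun 1 (suc k) ≡ 1ℤ
    peelSumRun-one k = trans (peelSumRun-suc 0 k)
      (trans (cong₂ _-_ (cong 𝟙 goodLen-0) (peelSumRun-zero k)) refl)

    peelSumRun-last : ∀ L k → peelSumRun L (suc k) ≡ peelSumRun L k + -1ℤ ^ k * (𝟙 (k <ᵇ L) * 𝟙 (goodLen d (L ∸ suc k)))
    peelSumRun-last L k = ∑-init-last k (λ i → -1ℤ ^ i * (𝟙 (i <ᵇ L) * 𝟙 (goodLen d (L ∸ suc i))))

    peelSum-firstRun : ∀ x l k → peelSum k (x ∷ l) ≡ peelSumRun (suc (firstRun x l)) k * 𝟙 (goodRuns d (drop (firstRun x l) l))
    peelSum-firstRun x l        zero    = refl
    peelSum-firstRun x []       (suc k) = trans (peelSum-[x] k x) (sym (trans (ℤP.*-identityʳ _) (peelSumRun-one k)))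
    peelSum-firstRun x (y ∷ l) (suc k) with x <ᵇ y | peelSum-∷∷ k x y l
    ... | false | unfold = trans unfold (trans (ℤP.+-identityʳ _)
                             (sym (trans (cong (_* 𝟙 (goodRuns d (y ∷ l))) (peelSumRun-one k)) (ℤP.*-identityˡ _))))
    ... | true  | unfold = trans unfold (begin
      𝟙 (goodRuns d (y ∷ l)) - 1ℤ * peelSum k (y ∷ l)        ≡⟨ cong₂ (λ u v → u - 1ℤ * v) (goodRuns-∷ d y l) (peelSum-firstRun y l k) ⟩
      𝟙 (goodLen d (suc R)) * G - 1ℤ * (peelSumRun (suc R) k * G)    ≡⟨ factor (𝟙 (goodLen d (suc R))) (peelSumRun (suc R) k) G ⟩
      (𝟙 (goodLen d (suc R)) - peelSumRun (suc R) k) * G             ≡⟨ cong (_* G) (peelSumRun-suc (suc R) k) ⟨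
      peelSumRun (suc (suc R)) (suc k) * G                           ∎)
      where
      open ≡-Reasoning
      R : ℕ
      R = firstRun y l
      G : ℤ
      G = 𝟙 (goodRuns d (drop R l))
      factor : ∀ a b g → a * g - 1ℤ * (b * g) ≡ (a - b) * g
      factor = solve-∀

  module OddRuns (r : ℕ) (r-odd : -1ℤ ^ r ≡ -1ℤ) where
    open Runs (suc r)

    peelSumRun-odd : ∀ L → peelSumRun (suc L) r ≡ 𝟙 (goodLen (suc r) (suc L))
    peelSumRun-odd zero    = begin
      peelSumRun 1 r                     ≡⟨ cong (peelSumRun 1) (r≡suc r r-odd) ⟩
      peelSumRun 1 (suc (r ∸ 1))         ≡⟨ peelSumRun-one (r ∸ 1) ⟩
      1ℤ                          ≡⟨ cong 𝟙 goodLen-1 ⟨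
      𝟙 (goodLen (suc r) 1)       ∎
      where
      open ≡-Reasoning
      r≡suc : ∀ r → -1ℤ ^ r ≡ -1ℤ → r ≡ suc (r ∸ 1)
      r≡suc (suc r) _ = refl
    peelSumRun-odd (suc L) = begin
      peelSumRun N r                    ≡⟨ add-sub (peelSumRun N r) X ⟩
      peelSumRun N r + X - X            ≡⟨ cong (_- X) (peelSumRun-last N r) ⟨
      peelSumRun N (suc r) - X          ≡⟨ cong (_- X) (peelSumRun-suc (suc L) r) ⟩
      G - peelSumRun (suc L) r - X      ≡⟨ cong (λ a → G - a - X) (peelSumRun-odd L) ⟩
      G - G - X                  ≡⟨ cong (λ s → G - G - s * Y) r-odd ⟩
      G - G - -1ℤ * Y            ≡⟨ cancel G Y ⟩
      Y                          ≡⟨ goodLen-periodic L ⟨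
      𝟙 (goodLen (suc r) N)      ∎
      where
      open ≡-Reasoning
      N : ℕ
      N = suc (suc L)
      G X Y : ℤ
      G = 𝟙 (goodLen (suc r) (suc L))
      Y = 𝟙 (r <ᵇ N) * 𝟙 (goodLen (suc r) (N ∸ suc r))
      X = -1ℤ ^ r * Y
      add-sub : ∀ a x → a ≡ a + x - x
      add-sub = solve-∀
      cancel : ∀ g y → g - g - -1ℤ * y ≡ y
      cancel = solve-∀

    goodRuns-peelSum : ∀ x l → 𝟙 (goodRuns (suc r) (x ∷ l)) ≡ peelSum r (x ∷ l)
    goodRuns-peelSum x l = begin
      𝟙 (goodRuns (suc r) (x ∷ l))                                              ≡⟨ goodRuns-∷ (suc r) x l ⟩
      𝟙 (goodLen (suc r) (suc (firstRun x l))) * 𝟙 (goodRuns (suc r) (drop (firstRun x l) l))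
        ≡⟨ cong (_* 𝟙 (goodRuns (suc r) (drop (firstRun x l) l))) (peelSumRun-odd (firstRun x l)) ⟨
      peelSumRun (suc (firstRun x l)) r * 𝟙 (goodRuns (suc r) (drop (firstRun x l) l)) ≡⟨ peelSum-firstRun x l r ⟨
      peelSum r (x ∷ l)                                                         ∎
      where open ≡-Reasoning

  word : ∀ {n k} → Vec (Fin k) n → List ℕ
  word v = map toℕ (toList v)

  word-++ : ∀ {p n k} (u : Vec (Fin k) p) (v : Vec (Fin k) n) → word (u ++ᵛ v) ≡ word u ++ word v
  word-++ []      v = refl
  word-++ (x ∷ u) v = cong (toℕ x ∷_) (word-++ u v)

  length-word : ∀ {n k} (v : Vec (Fin k) n) → length (word v) ≡ n
  length-word []      = refl
  length-word (x ∷ v) = cong suc (length-word v)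

  take-word : ∀ {p k} (u : Vec (Fin k) p) l → take p (word u ++ l) ≡ word u
  take-word []      l = refl
  take-word (x ∷ u) l = cong (toℕ x ∷_) (take-word u l)

  drop-word : ∀ {p k} (u : Vec (Fin k) p) l → drop p (word u ++ l) ≡ l
  drop-word []      l = refl
  drop-word (x ∷ u) l = drop-word u l

  notIn : ℕ → List ℕ → Bool
  notIn x = all (λ y → not ⌊ x ℕ.≟ y ⌋)

  𝟙-distinct-++ : ∀ us vs → 𝟙 (distinct (us ++ vs)) ≡ 𝟙 (distinct us) * 𝟙 (all (λ x → notIn x vs) us) * 𝟙 (distinct vs)
  𝟙-distinct-++ []       vs = sym (ℤP.*-identityˡ _)
  𝟙-distinct-++ (x ∷ us) vs = begin
    𝟙 (notIn x (us ++ vs) ∧ distinct (us ++ vs))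
      ≡⟨ 𝟙-∧ (notIn x (us ++ vs)) _ ⟩
    𝟙 (notIn x (us ++ vs)) * 𝟙 (distinct (us ++ vs))
      ≡⟨ cong₂ _*_ (𝟙-all-++ (λ y → not ⌊ x ℕ.≟ y ⌋) us vs) (𝟙-distinct-++ us vs) ⟩
    (𝟙 (notIn x us) * 𝟙 (notIn x vs)) * (𝟙 (distinct us) * 𝟙 (all (λ y → notIn y vs) us) * 𝟙 (distinct vs))
      ≡⟨ regroup (𝟙 (notIn x us)) (𝟙 (notIn x vs)) (𝟙 (distinct us)) _ _ ⟩
    (𝟙 (notIn x us) * 𝟙 (distinct us)) * (𝟙 (notIn x vs) * 𝟙 (all (λ y → notIn y vs) us)) * 𝟙 (distinct vs)
      ≡⟨ cong₂ (λ a b → a * b * 𝟙 (distinct vs)) (𝟙-∧ (notIn x us) _) (𝟙-∧ (notIn x vs) _) ⟨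
    𝟙 (notIn x us ∧ distinct us) * 𝟙 (notIn x vs ∧ all (λ y → notIn y vs) us) * 𝟙 (distinct vs)
      ∎
    where
    open ≡-Reasoning
    regroup : ∀ a b c e f → (a * b) * (c * e * f) ≡ (a * c) * (b * e) * f
    regroup = solve-∀

  ascending-∷ : ∀ x l → ascending (x ∷ l) ≡ all (x <ᵇ_) l ∧ ascending l
  ascending-∷ x []      = refl
  ascending-∷ x (y ∷ l) with x <ᵇ y in x<y
  ... | false = refl
  ... | true  = absorb (ascending (y ∷ l)) (all (x <ᵇ_) l) above-x
    where
    absorb : ∀ c a → (c ≡ true → a ≡ true) → c ≡ a ∧ c
    absorb false a _ = sym (∧-zeroʳ a)
    absorb true  a h rewrite h refl = refl
    above-x : ascending (y ∷ l) ≡ true → all (x <ᵇ_) l ≡ true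
    above-x asc = all-mono (λ z → <ᵇ-trans x y z x<y) l (proj₁ ∧-conical _ _ (trans (sym (ascending-∷ y l)) asc))

  ascending⇒distinct : ∀ l → ascending l ≡ true → distinct l ≡ true
  ascending⇒distinct []      _   = refl
  ascending⇒distinct (x ∷ l) asc =
    cong₂ _∧_ (all-mono (<ᵇ⇒≢ x) l (proj₁ ∧-conical _ _ asc′)) (ascending⇒distinct l (proj₂ ∧-conical _ _ asc′))
    where
    asc′ : (all (x <ᵇ_) l ∧ ascending l) ≡ true
    asc′ = trans (sym (ascending-∷ x l)) asc

  countBelow : ℕ → (ℕ → Bool) → ℕ
  countBelow zero    B = 0
  countBelow (suc k) B = (if B 0 then 1 else 0) ℕ.+ countBelow k (λ y → B (suc y))

  countBelow-cong : ∀ k {B B′ : ℕ → Bool} → (∀ x → B x ≡ B′ x) → countBelow k B ≡ countBelow k B′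
  countBelow-cong zero    eq = refl
  countBelow-cong (suc k) eq = cong₂ (λ b c → (if b then 1 else 0) ℕ.+ c) (eq 0) (countBelow-cong k (λ x → eq (suc x)))

  countBelow-true : ∀ k → countBelow k (λ _ → true) ≡ k
  countBelow-true zero    = refl
  countBelow-true (suc k) = cong suc (countBelow-true k)

  ⌊suc≟suc⌋ℕ : ∀ x y → ⌊ suc x ℕ.≟ suc y ⌋ ≡ ⌊ x ℕ.≟ y ⌋
  ⌊suc≟suc⌋ℕ x y = trans (isYes≗does (suc x ℕ.≟ suc y))
    (trans (does-⇔ (mk⇔ ℕP.suc-injective (cong suc)) (suc x ℕ.≟ suc y) (x ℕ.≟ y)) (sym (isYes≗does (x ℕ.≟ y))))

  countBelow-remove : ∀ k y (B : ℕ → Bool) → y < k → B y ≡ true →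
    suc (countBelow k (λ x → not ⌊ x ℕ.≟ y ⌋ ∧ B x)) ≡ countBelow k B
  countBelow-remove (suc k) zero    B _ By rewrite By = refl
  countBelow-remove (suc k) (suc y) B (s≤s y<k) By = begin
    suc ((if B 0 then 1 else 0) ℕ.+ countBelow k (λ x → not ⌊ suc x ℕ.≟ suc y ⌋ ∧ B (suc x)))
      ≡⟨ ℕP.+-suc (if B 0 then 1 else 0) _ ⟨
    (if B 0 then 1 else 0) ℕ.+ suc (countBelow k (λ x → not ⌊ suc x ℕ.≟ suc y ⌋ ∧ B (suc x)))
      ≡⟨ cong (λ c → (if B 0 then 1 else 0) ℕ.+ suc c)
           (countBelow-cong k (λ x → cong (λ b → not b ∧ B (suc x)) (⌊suc≟suc⌋ℕ x y))) ⟩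
    (if B 0 then 1 else 0) ℕ.+ suc (countBelow k (λ x → not ⌊ x ℕ.≟ y ⌋ ∧ B (suc x)))
      ≡⟨ cong ((if B 0 then 1 else 0) ℕ.+_) (countBelow-remove k y (λ x → B (suc x)) y<k By) ⟩
    countBelow (suc k) B
      ∎
    where open ≡-Reasoning

  countBelow-notIn : ∀ {n k} (v : Vec (Fin k) n) → distinct (word v) ≡ true →
    countBelow k (λ x → notIn x (word v)) ≡ k ∸ n
  countBelow-notIn {k = k} []      _        = countBelow-true k
  countBelow-notIn {suc n} {k} (y ∷ v) distinct-yv = begin
    countBelow k (λ x → not ⌊ x ℕ.≟ toℕ y ⌋ ∧ notIn x (word v))
      ≡⟨⟩
    pred (suc (countBelow k (λ x → not ⌊ x ℕ.≟ toℕ y ⌋ ∧ notIn x (word v))))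
      ≡⟨ cong pred (countBelow-remove k (toℕ y) (λ x → notIn x (word v)) (FinP.toℕ<n y)
                      (proj₁ ∧-conical _ _ distinct-yv)) ⟩
    pred (countBelow k (λ x → notIn x (word v)))
      ≡⟨ cong pred (countBelow-notIn v (proj₂ ∧-conical _ _ distinct-yv)) ⟩
    pred (k ∸ n)
      ≡⟨ ℕP.pred[m∸n]≡m∸[1+n] k n ⟩
    k ∸ suc n
      ∎
    where open ≡-Reasoning

  C-hockey-stick : ∀ p k (B : ℕ → Bool) →
    ∑[ j < k ] (𝟙 (B (toℕ j)) * + (countBelow k (λ y → (toℕ j <ᵇ y) ∧ B y) C p)) ≡ + (countBelow k B C suc p)
  C-hockey-stick p zero    B = refl
  C-hockey-stick p (suc k) B =
    trans (cong (_+_ (𝟙 (B 0) * + (c C p))) (C-hockey-stick p k (λ y → B (suc y)))) (first (B 0))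
    where
    c : ℕ
    c = countBelow k (λ y → B (suc y))
    first : ∀ b → 𝟙 b * + (c C p) + + (c C suc p) ≡ + (((if b then 1 else 0) ℕ.+ c) C suc p)
    first true  = trans (cong (_+ + (c C suc p)) (ℤP.*-identityˡ (+ (c C p))))
                        (trans (sym (ℤP.pos-+ (c C p) (c C suc p))) (cong +_ (sym (C-pascal c p))))
    first false = ℤP.+-identityˡ _

  𝟙-ascending-all-∷ : ∀ x l (B : ℕ → Bool) →
    𝟙 (ascending (x ∷ l) ∧ all B (x ∷ l)) ≡ 𝟙 (B x) * 𝟙 (ascending l ∧ all (λ y → (x <ᵇ y) ∧ B y) l)
  𝟙-ascending-all-∷ x l B = begin
    𝟙 (ascending (x ∷ l) ∧ (B x ∧ all B l))
      ≡⟨ trans (𝟙-∧ (ascending (x ∷ l)) _)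
           (cong₂ _*_ (trans (cong 𝟙 (ascending-∷ x l)) (𝟙-∧ (all (x <ᵇ_) l) (ascending l))) (𝟙-∧ (B x) _)) ⟩
    (𝟙 (all (x <ᵇ_) l) * 𝟙 (ascending l)) * (𝟙 (B x) * 𝟙 (all B l))
      ≡⟨ regroup (𝟙 (all (x <ᵇ_) l)) (𝟙 (ascending l)) (𝟙 (B x)) (𝟙 (all B l)) ⟩
    𝟙 (B x) * (𝟙 (ascending l) * (𝟙 (all (x <ᵇ_) l) * 𝟙 (all B l)))
      ≡⟨ cong (λ z → 𝟙 (B x) * (𝟙 (ascending l) * z)) (𝟙-all-∧ (x <ᵇ_) B l) ⟨
    𝟙 (B x) * (𝟙 (ascending l) * 𝟙 (all (λ y → (x <ᵇ y) ∧ B y) l))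
      ≡⟨ cong (𝟙 (B x) *_) (𝟙-∧ (ascending l) _) ⟨
    𝟙 (B x) * 𝟙 (ascending l ∧ all (λ y → (x <ᵇ y) ∧ B y) l)
      ∎
    where
    open ≡-Reasoning
    regroup : ∀ a s b t → (a * s) * (b * t) ≡ b * (s * (a * t))
    regroup = solve-∀

  ascending-words : ∀ p k (B : ℕ → Bool) →
    ∑[ u ∈ allVecs p k ] 𝟙 (ascending (word u) ∧ all B (word u)) ≡ + (countBelow k B C p)
  ascending-words zero    k B = refl
  ascending-words (suc p) k B = begin
    ∑[ u ∈ allVecs (suc p) k ] 𝟙 (ascending (word u) ∧ all B (word u))
      ≡⟨ sumOver-allVecs-suc p k (λ u → 𝟙 (ascending (word u) ∧ all B (word u))) ⟩
    ∑[ w ∈ allVecs p k ] ∑[ x < k ] 𝟙 (ascending (toℕ x ∷ word w) ∧ all B (toℕ x ∷ word w))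
      ≡⟨ sumOver-cong (allVecs p k) (λ w → ∑-cong k (λ x → 𝟙-ascending-all-∷ (toℕ x) (word w) B)) ⟩
    ∑[ w ∈ allVecs p k ] ∑[ x < k ] (𝟙 (B (toℕ x)) * 𝟙 (ascending (word w) ∧ all (above (toℕ x)) (word w)))
      ≡⟨ sumOver-comm-∑ (allVecs p k) k (λ w x → 𝟙 (B (toℕ x)) * 𝟙 (ascending (word w) ∧ all (above (toℕ x)) (word w))) ⟩
    ∑[ x < k ] ∑[ w ∈ allVecs p k ] (𝟙 (B (toℕ x)) * 𝟙 (ascending (word w) ∧ all (above (toℕ x)) (word w)))
      ≡⟨ ∑-cong k (λ x → trans (sym (*-distribˡ-sumOver (𝟙 (B (toℕ x))) (allVecs p k) _))
                               (cong (𝟙 (B (toℕ x)) *_) (ascending-words p k (above (toℕ x))))) ⟩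
    ∑[ x < k ] (𝟙 (B (toℕ x)) * + (countBelow k (above (toℕ x)) C p))
      ≡⟨ C-hockey-stick p k B ⟩
    + (countBelow k B C suc p)
      ∎
    where
    open ≡-Reasoning
    above : ℕ → ℕ → Bool
    above x y = (x <ᵇ y) ∧ B y

  𝟙-distinct-ascending : ∀ l → 𝟙 (distinct l) * 𝟙 (ascending l) ≡ 𝟙 (ascending l)
  𝟙-distinct-ascending l with ascending l in asc
  ... | false = ℤP.*-zeroʳ (𝟙 (distinct l))
  ... | true  rewrite ascending⇒distinct l asc = refl

  module InjectiveWords (r : ℕ) (r-odd : -1ℤ ^ r ≡ -1ℤ) where
    open Runs (suc r)
    open OddRuns r r-odd

    goodInjective : ℕ → ℕ → ℤ
    goodInjective ℓ k = ∑[ w ∈ allVecs ℓ k ] (𝟙 (distinct (word w)) * 𝟙 (goodRuns (suc r) (word w)))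

    peelCount : ℕ → ℕ → ℕ → ℤ
    peelCount i ℓ k = ∑[ w ∈ allVecs ℓ k ] (𝟙 (distinct (word w)) * peeled (suc i) (word w))

    goodInjective-peel : ∀ n k → goodInjective (suc n) k ≡ ∑[ i < r ] (-1ℤ ^ toℕ i * peelCount (toℕ i) (suc n) k)
    goodInjective-peel n k = begin
      ∑[ w ∈ allVecs (suc n) k ] (𝟙 (distinct (word w)) * 𝟙 (goodRuns (suc r) (word w)))
        ≡⟨ sumOver-cong (allVecs (suc n) k) expand ⟩
      ∑[ w ∈ allVecs (suc n) k ] ∑[ i < r ] (-1ℤ ^ toℕ i * (𝟙 (distinct (word w)) * peeled (suc (toℕ i)) (word w)))
        ≡⟨ sumOver-comm-∑ (allVecs (suc n) k) r _ ⟩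
      ∑[ i < r ] ∑[ w ∈ allVecs (suc n) k ] (-1ℤ ^ toℕ i * (𝟙 (distinct (word w)) * peeled (suc (toℕ i)) (word w)))
        ≡⟨ ∑-cong r (λ i → sym (*-distribˡ-sumOver (-1ℤ ^ toℕ i) (allVecs (suc n) k) _)) ⟩
      ∑[ i < r ] (-1ℤ ^ toℕ i * peelCount (toℕ i) (suc n) k)
        ∎
      where
      open ≡-Reasoning
      good-peel : ∀ (w : Vec (Fin k) (suc n)) → 𝟙 (goodRuns (suc r) (word w)) ≡ peelSum r (word w)
      good-peel (x ∷ w) = goodRuns-peelSum (toℕ x) (word w)
      swap : ∀ d s p → d * (s * p) ≡ s * (d * p)
      swap = solve-∀
      expand : ∀ w → 𝟙 (distinct (word w)) * 𝟙 (goodRuns (suc r) (word w)) ≡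
                     ∑[ i < r ] (-1ℤ ^ toℕ i * (𝟙 (distinct (word w)) * peeled (suc (toℕ i)) (word w)))
      expand w = trans (cong (𝟙 (distinct (word w)) *_) (good-peel w))
        (trans (*-distribˡ-sum {r} (𝟙 (distinct (word w))) _)
               (∑-cong r (λ i → swap (𝟙 (distinct (word w))) (-1ℤ ^ toℕ i) (peeled (suc (toℕ i)) (word w)))))

    peelCount-short : ∀ i ℓ k → ℓ < suc i → peelCount i ℓ k ≡ 0ℤ
    peelCount-short i ℓ k ℓ<i+1 = sumOver-zero (allVecs ℓ k) λ w →
      trans (cong (λ b → 𝟙 (distinct (word w)) *
                         (𝟙 (b ∧ ascending (take (suc i) (word w))) * 𝟙 (goodRuns (suc r) (drop (suc i) (word w)))))
                  (trans (cong (suc i ≤ᵇ_) (length-word w)) (≤ᵇ-false ℓ<i+1)))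
            (ℤP.*-zeroʳ (𝟙 (distinct (word w))))

    peel-++ : ∀ {i n k} (u : Vec (Fin k) (suc i)) (v : Vec (Fin k) n) →
      𝟙 (distinct (word (u ++ᵛ v))) * peeled (suc i) (word (u ++ᵛ v)) ≡
      (𝟙 (distinct (word v)) * 𝟙 (goodRuns (suc r) (word v))) * 𝟙 (ascending (word u) ∧ all (λ x → notIn x (word v)) (word u))
    peel-++ {i} {n} u v = begin
      𝟙 (distinct (word (u ++ᵛ v))) * peeled (suc i) (word (u ++ᵛ v))
        ≡⟨ cong (λ l → 𝟙 (distinct l) * peeled (suc i) l) (word-++ u v) ⟩
      𝟙 (distinct (U ++ V)) *
        (𝟙 ((suc i ≤ᵇ length (U ++ V)) ∧ ascending (take (suc i) (U ++ V))) * 𝟙 (goodRuns (suc r) (drop (suc i) (U ++ V))))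
        ≡⟨ cong₂ (λ b t → 𝟙 (distinct (U ++ V)) * (𝟙 (b ∧ ascending t) * 𝟙 (goodRuns (suc r) (drop (suc i) (U ++ V)))))
                 long (take-word u V) ⟩
      𝟙 (distinct (U ++ V)) * (𝟙 (ascending U) * 𝟙 (goodRuns (suc r) (drop (suc i) (U ++ V))))
        ≡⟨ cong (λ l → 𝟙 (distinct (U ++ V)) * (𝟙 (ascending U) * 𝟙 (goodRuns (suc r) l))) (drop-word u V) ⟩
      𝟙 (distinct (U ++ V)) * (𝟙 (ascending U) * 𝟙 (goodRuns (suc r) V))
        ≡⟨ cong (_* (𝟙 (ascending U) * 𝟙 (goodRuns (suc r) V))) (𝟙-distinct-++ U V) ⟩
      (𝟙 (distinct U) * 𝟙 (all (λ x → notIn x V) U) * 𝟙 (distinct V)) * (𝟙 (ascending U) * 𝟙 (goodRuns (suc r) V))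
        ≡⟨ regroup (𝟙 (distinct U)) (𝟙 (all (λ x → notIn x V) U)) (𝟙 (distinct V)) (𝟙 (ascending U)) _ ⟩
      (𝟙 (distinct V) * 𝟙 (goodRuns (suc r) V)) * ((𝟙 (distinct U) * 𝟙 (ascending U)) * 𝟙 (all (λ x → notIn x V) U))
        ≡⟨ cong (λ z → (𝟙 (distinct V) * 𝟙 (goodRuns (suc r) V)) * (z * 𝟙 (all (λ x → notIn x V) U))) (𝟙-distinct-ascending U) ⟩
      (𝟙 (distinct V) * 𝟙 (goodRuns (suc r) V)) * (𝟙 (ascending U) * 𝟙 (all (λ x → notIn x V) U))
        ≡⟨ cong ((𝟙 (distinct V) * 𝟙 (goodRuns (suc r) V)) *_) (𝟙-∧ (ascending U) _) ⟨
      (𝟙 (distinct V) * 𝟙 (goodRuns (suc r) V)) * 𝟙 (ascending U ∧ all (λ x → notIn x V) U)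
        ∎
      where
      open ≡-Reasoning
      U V : List ℕ
      U = word u
      V = word v
      long : (suc i ≤ᵇ length (U ++ V)) ≡ true
      long = ≤ᵇ-true (subst (suc i ≤_) (sym (trans (length-++ U) (cong₂ ℕ._+_ (length-word u) (length-word v))))
                                       (ℕP.m≤m+n (suc i) n))
      regroup : ∀ du a dv s g → (du * a * dv) * (s * g) ≡ (dv * g) * ((du * s) * a)
      regroup = solve-∀

    peelCount-split : ∀ i n k → peelCount i (suc i ℕ.+ n) k ≡ + ((k ∸ n) C suc i) * goodInjective n k
    peelCount-split i n k = begin
      peelCount i (suc i ℕ.+ n) k
        ≡⟨ sumOver-allVecs-++ (suc i) n k _ ⟩
      ∑[ v ∈ allVecs n k ] ∑[ u ∈ allVecs (suc i) k ] (𝟙 (distinct (word (u ++ᵛ v))) * peeled (suc i) (word (u ++ᵛ v)))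
        ≡⟨ sumOver-cong (allVecs n k) (λ v → trans (sumOver-cong (allVecs (suc i) k) (λ u → peel-++ u v))
             (trans (sym (*-distribˡ-sumOver (G v) (allVecs (suc i) k) _)) (cong (G v *_) (ascending-words (suc i) k _)))) ⟩
      ∑[ v ∈ allVecs n k ] (G v * + (countBelow k (λ x → notIn x (word v)) C suc i))
        ≡⟨ sumOver-cong (allVecs n k) available ⟩
      ∑[ v ∈ allVecs n k ] (+ ((k ∸ n) C suc i) * G v)
        ≡⟨ *-distribˡ-sumOver (+ ((k ∸ n) C suc i)) (allVecs n k) G ⟨
      + ((k ∸ n) C suc i) * goodInjective n k
        ∎
      where
      open ≡-Reasoning
      G H : Vec (Fin k) n → ℤ
      H v = 𝟙 (goodRuns (suc r) (word v))
      G v = 𝟙 (distinct (word v)) * H v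
      available : ∀ v → G v * + (countBelow k (λ x → notIn x (word v)) C suc i) ≡ + ((k ∸ n) C suc i) * G v
      available v with distinct (word v) in distinct-v
      ... | true  = trans (cong (λ c → 1ℤ * H v * + (c C suc i)) (countBelow-notIn v distinct-v)) (ℤP.*-comm (1ℤ * H v) _)
      ... | false = sym (ℤP.*-zeroʳ (+ ((k ∸ n) C suc i)))

    module _ (Q : ℕ → ℤ) (Q-zero : Q 0 ≡ 1ℤ)
             (Q-suc : ∀ n → Q (suc n) + ∑[ i < r ] (+ (suc n C suc (toℕ i)) * Q (n ∸ toℕ i)) ≡ 0ℤ) where

      goodInjective-closed : ∀ ℓ k → goodInjective ℓ k ≡ + (k C ℓ) * (-1ℤ ^ ℓ * Q ℓ)
      goodInjective-closed = <-rec _ step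
        where
        step : ∀ ℓ → (∀ {m} → m < ℓ → ∀ k → goodInjective m k ≡ + (k C m) * (-1ℤ ^ m * Q m)) →
               ∀ k → goodInjective ℓ k ≡ + (k C ℓ) * (-1ℤ ^ ℓ * Q ℓ)
        step zero    _  k = sym (trans (ℤP.*-identityˡ _) (trans (ℤP.*-identityˡ _) Q-zero))
        step (suc n) ih k = begin
          goodInjective (suc n) k
            ≡⟨ goodInjective-peel n k ⟩
          ∑[ i < r ] (-1ℤ ^ toℕ i * peelCount (toℕ i) (suc n) k)
            ≡⟨ ∑-cong r (λ i → term (toℕ i)) ⟩
          ∑[ i < r ] (X * (+ (suc n C suc (toℕ i)) * Q (n ∸ toℕ i)))
            ≡⟨ *-distribˡ-sum {r} X _ ⟨
          X * ∑[ i < r ] (+ (suc n C suc (toℕ i)) * Q (n ∸ toℕ i))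
            ≡⟨ cong (X *_) (trans (add-sub (Q (suc n)) _) (cong (_- Q (suc n)) (Q-suc n))) ⟩
          X * (0ℤ - Q (suc n))
            ≡⟨ finish (+ (k C suc n)) (-1ℤ ^ suc n) (Q (suc n)) ⟩
          + (k C suc n) * (-1ℤ ^ suc n * Q (suc n))
            ∎
          where
          open ≡-Reasoning
          X : ℤ
          X = - (+ (k C suc n) * -1ℤ ^ suc n)
          add-sub : ∀ q s → s ≡ q + s - q
          add-sub = solve-∀
          finish : ∀ c s q → - (c * s) * (0ℤ - q) ≡ c * (s * q)
          finish = solve-∀
          term : ∀ i → -1ℤ ^ i * peelCount i (suc n) k ≡ X * (+ (suc n C suc i) * Q (n ∸ i))
          term i with ℕP.≤-<-connex i n
          ... | inj₂ n<i = begin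
            -1ℤ ^ i * peelCount i (suc n) k      ≡⟨ cong (-1ℤ ^ i *_) (peelCount-short i (suc n) k (s≤s n<i)) ⟩
            -1ℤ ^ i * 0ℤ                        ≡⟨ ℤP.*-zeroʳ (-1ℤ ^ i) ⟩
            0ℤ                                  ≡⟨ ℤP.*-zeroʳ X ⟨
            X * 0ℤ                              ≡⟨ cong (λ c → X * (+ c * Q (n ∸ i))) (nCk≡0 (s≤s n<i)) ⟨
            X * (+ (suc n C suc i) * Q (n ∸ i)) ∎
          ... | inj₁ i≤n = begin
            -1ℤ ^ i * peelCount i (suc n) k
              ≡⟨ cong (λ ℓ → -1ℤ ^ i * peelCount i (suc ℓ) k) (ℕP.m+[n∸m]≡n i≤n) ⟨
            -1ℤ ^ i * peelCount i (suc i ℕ.+ (n ∸ i)) k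
              ≡⟨ cong (-1ℤ ^ i *_) (trans (peelCount-split i (n ∸ i) k)
                                          (cong (+ ((k ∸ (n ∸ i)) C suc i) *_) (ih (s≤s (ℕP.m∸n≤m n i)) k))) ⟩
            -1ℤ ^ i * (+ ((k ∸ (n ∸ i)) C suc i) * (+ (k C (n ∸ i)) * (-1ℤ ^ (n ∸ i) * Q (n ∸ i))))
              ≡⟨ C-signed-subset-of-subset k n i i≤n (Q (n ∸ i)) ⟩
            X * (+ (suc n C suc i) * Q (n ∸ i))
              ∎

  odd⇒1≤ : ∀ r → -1ℤ ^ r ≡ -1ℤ → 1 ≤ r
  odd⇒1≤ (suc r) _ = s≤s z≤n

  -1^[2m-1] : ∀ m → 1 ≤ m → -1ℤ ^ (2 ℕ.* m ∸ 1) ≡ -1ℤ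
  -1^[2m-1] (suc m) _ = begin
    -1ℤ ^ (m ℕ.+ suc (m ℕ.+ 0))          ≡⟨ ℤP.^-distribˡ-+-* -1ℤ m (suc (m ℕ.+ 0)) ⟩
    -1ℤ ^ m * -1ℤ ^ suc (m ℕ.+ 0)        ≡⟨ cong (λ e → -1ℤ ^ m * -1ℤ ^ suc e) (ℕP.+-identityʳ m) ⟩
    -1ℤ ^ m * -1ℤ ^ suc m                ≡⟨ cong (-1ℤ ^ m *_) (-1^suc m) ⟩
    -1ℤ ^ m * - (-1ℤ ^ m)                ≡⟨ ℤP.neg-distribʳ-* (-1ℤ ^ m) (-1ℤ ^ m) ⟨
    - (-1ℤ ^ m * -1ℤ ^ m)                ≡⟨ cong -_ (-1^n*-1^n m) ⟩
    -1ℤ                                  ∎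
    where open ≡-Reasoning

  a≡sumOver : ∀ n m → + a n m ≡ ∑[ v ∈ allVecs n n ] (𝟙 (distinct (word v)) * 𝟙 (goodRuns (2 ℕ.* m) (word v)))
  a≡sumOver n m = trans (count≡sumOver _ (allVecs n n))
    (sumOver-cong (allVecs n n) (λ v → 𝟙-∧ (distinct (word v)) (goodRuns (2 ℕ.* m) (word v))))

  module AtMinusOne (r : ℕ) (r-odd : -1ℤ ^ r ≡ -1ℤ) where
    open ChromaticPolynomial r
    open InjectiveWords r r-odd

    χ-suc-at-minus-one : ∀ n → χ (suc n) -1ℤ + ∑[ i < r ] (+ (suc n C suc (toℕ i)) * χ (n ∸ toℕ i) -1ℤ) ≡ 0ℤ
    χ-suc-at-minus-one n =
      trans (cong (_+ ∑[ i < r ] (+ (suc n C suc (toℕ i)) * χ (n ∸ toℕ i) -1ℤ)) (sym (ℤP.*-identityˡ (χ (suc n) -1ℤ))))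
            (trans (sym (χ[q+1]≡colourSplit (suc n) -1ℤ)) (χ-suc-at-0 n))

    χ-at-minus-one : ∀ n → -1ℤ ^ n * goodInjective n n ≡ χ n -1ℤ
    χ-at-minus-one n = begin
      -1ℤ ^ n * goodInjective n n
        ≡⟨ cong (-1ℤ ^ n *_) (goodInjective-closed (λ ℓ → χ ℓ -1ℤ) (χ-zero -1ℤ) χ-suc-at-minus-one n n) ⟩
      -1ℤ ^ n * (+ (n C n) * (-1ℤ ^ n * χ n -1ℤ))
        ≡⟨ cong (λ c → -1ℤ ^ n * (+ c * (-1ℤ ^ n * χ n -1ℤ))) (nCn≡1 n) ⟩
      -1ℤ ^ n * (1ℤ * (-1ℤ ^ n * χ n -1ℤ))
        ≡⟨ regroup (-1ℤ ^ n) (χ n -1ℤ) ⟩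
      (-1ℤ ^ n * -1ℤ ^ n) * χ n -1ℤ
        ≡⟨ cong (_* χ n -1ℤ) (-1^n*-1^n n) ⟩
      1ℤ * χ n -1ℤ
        ≡⟨ ℤP.*-identityˡ (χ n -1ℤ) ⟩
      χ n -1ℤ
        ∎
      where
      open ≡-Reasoning
      regroup : ∀ s x → s * (1ℤ * (s * x)) ≡ (s * s) * x
      regroup = solve-∀

open import Data.Nat using (ℕ; suc; _≤_; _*_; _∸_)
open import Data.List using (List)
open import Data.Integer using (ℤ; +_; -1ℤ) renaming (_*_ to _*ℤ_; _^_ to _^ℤ_)
open import Data.Product using (Σ; _×_; _,_)
open import Relation.Binary.PropositionalEquality using (_≡_; sym; trans; cong)

proposition1 : (m n : ℕ) → 1 ≤ m → 1 ≤ n →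
    Σ (List ℤ) (λ P →
      ((q : ℕ) → 1 ≤ q → evalPoly P (+ q) ≡ + chiCount (2 * m ∸ 1) (K n) q)
      × evalPoly P -1ℤ ≡ (-1ℤ ^ℤ n) *ℤ (+ a n m))
proposition1 m@(suc _) n 1≤m _ = poly n , values , at-minus-one
  where
  r : ℕ
  r = 2 * m ∸ 1
  r-odd : -1ℤ ^ℤ r ≡ -1ℤ
  r-odd = -1^[2m-1] m 1≤m
  open ChromaticPolynomial r
  open AtMinusOne r r-odd
  values : (q : ℕ) → 1 ≤ q → χ n (+ q) ≡ + chiCount r (K n) q
  values q _ = trans (χ≡colourings r q n) (sym (chiCount-K≡colourings r n q (odd⇒1≤ r r-odd)))
  at-minus-one : χ n -1ℤ ≡ (-1ℤ ^ℤ n) *ℤ (+ a n m)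
  at-minus-one = sym (trans (cong ((-1ℤ ^ℤ n) *ℤ_) (a≡sumOver n m)) (χ-at-minus-one n))
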